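{- For all $n,k\in\mathbb{N}$, $$S_B[n,k]=\sum_{\rho\in S_B(\langle n\rangle,k)} q^{\operatorname{maj}\rho}.$$
   Context: $[m]=(1-q^m)/(1-q)$; $S_B[n,k]$ is defined by $S_B[0,k]=\delta_{0,k}$ ($k\in\mathbb{Z}$) and $S_B[n,k]=S_B[n-1,k-1]+[2k+1]S_B[n-1,k]$ for $n\ge1$. Let $\langle n\rangle=\{ -n,\ldots,n\}$. A signed partition of $\langle n\rangle$ is a set partition of $\langle n\rangle$ into blocks $S_0,S_1,\ldots,S_{2k}$ such that $0\in S_0$, $S_0=-S_0$, and the other blocks come in pairs $\{B,-B\}$ with $B\neq -B$ (where $-B=\{ -b:b\in B\}$); $S_B(\langle n\rangle,k)$ is the set of those with $2k+1$ blocks. Standard form: $S_0$ is the block containing $0$; for each pair $\{B,-B\}$ let $m=\min\{|b|:b\in B\}$, and label the pairs so that the pair with the $i$-th smallest $m$ is $\{S_{2i-1},S_{2i}\}$ with $m\in S_{2i}$, $S_{2i-1}=-S_{2i}$. Let $m_j=\min\{|s|:s\in S_j\}$. For $1\le i\le 2k$ let $n_i$ be the number of elements of $S_{i-1}$ that are greater than $m_i$, and define $\operatorname{maj}\rho=\sum_{i=1}^{2k} i\, n_i$. -}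

module Defs where

open import Level using (Level)
open import Algebra.Bundles using (CommutativeSemiring)
open import Data.Bool using (T?; Bool; true; false; _∧_; _∨_; not; if_then_else_)
open import Data.Nat as ℕ using (ℕ; zero; suc; _≡ᵇ_; _<ᵇ_; _⊓_)
open import Data.Integer as ℤ using (ℤ; +_; -_; ∣_∣)
open import Data.List using (List; []; _∷_; map; filter; concatMap; foldr; length; upTo)
open import Relation.Nullary using (does)

-- q-arithmetic in an arbitrary commutative semiring R, q ∈ R.
-- Taking R = ℕ[q] (or ℤ[q]) recovers the formal polynomial identity.

module QArith {c ℓ : Level} (R : CommutativeSemiring c ℓ) (q : CommutativeSemiring.Carrier R) where
  open CommutativeSemiring R using (Carrier; _+_; _*_; 0#; 1#)

  pow : ℕ → Carrier
  pow zero    = 1#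
  pow (suc m) = q * pow m

  qint : ℕ → Carrier
  qint zero    = 0#
  qint (suc m) = 1# + q * qint m

  -- S_B[n,k] for k ∈ ℕ:  S_B[0,k] = δ_{0,k},
  -- S_B[n,k] = S_B[n-1,k-1] + [2k+1] S_B[n-1,k]   (S_B[n-1,-1] = 0)
  SB : ℕ → ℕ → Carrier
  SB zero    zero    = 1#
  SB zero    (suc k) = 0#
  SB (suc n) zero    = qint 1 * SB n zero
  SB (suc n) (suc k) = SB n k + qint (suc (2 ℕ.* suc k)) * SB n (suc k)

  sumR : List Carrier → Carrier
  sumR = foldr _+_ 0#

-- Signed partitions of ⟨n⟩ = {-n,…,n} in standard form, encoded as
-- labellings ρ : ℤ → ℕ, where ρ x = j means x ∈ S_j (only the values on
-- ⟨n⟩ matter).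

all : {A : Set} → (A → Bool) → List A → Bool
all p []       = true
all p (x ∷ xs) = p x ∧ all p xs

angle : ℕ → List ℤ
angle n = map (λ i → (+ i) ℤ.- (+ n)) (upTo (suc (2 ℕ.* n)))

block : ℕ → (ℤ → ℕ) → ℕ → List ℤ
block n ρ j = filter (λ x → ρ x ℕ.≟ j) (angle n)

-- min { |s| : s ∈ B }  (B nonempty in all uses)
minAbs : List ℤ → ℕ
minAbs []       = 0
minAbs (x ∷ xs) = foldr (λ y r → ∣ y ∣ ⊓ r) ∣ x ∣ xs

mblk : ℕ → (ℤ → ℕ) → ℕ → ℕ
mblk n ρ j = minAbs (block n ρ j)

nonEmpty : List ℤ → Bool
nonEmpty [] = false
nonEmpty (_ ∷ _) = true

isStdSignedPartition : ℕ → ℕ → (ℤ → ℕ) → Bool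
isStdSignedPartition n k ρ =
      all (λ x → ρ x <ᵇ suc (2 ℕ.* k)) (angle n)
   ∧ (ρ (+ 0) ≡ᵇ 0)
   ∧ all (λ j → nonEmpty (block n ρ j)) (upTo (suc (2 ℕ.* k)))
   ∧ all (λ x → not (ρ x ≡ᵇ 0) ∨ (ρ (- x) ≡ᵇ 0)) (angle n)        -- S_0 = -S_0
   ∧ all (λ i → all (λ x →                                        -- S_{2i-1} = -S_{2i}
            (not (ρ x ≡ᵇ 2 ℕ.* i) ∨ (ρ (- x) ≡ᵇ 2 ℕ.* i ℕ.∸ 1))
          ∧ (not (ρ x ≡ᵇ 2 ℕ.* i ℕ.∸ 1) ∨ (ρ (- x) ≡ᵇ 2 ℕ.* i)))
          (angle n)) (map suc (upTo k))
   ∧ all (λ i → ρ (+ mblk n ρ (2 ℕ.* i)) ≡ᵇ 2 ℕ.* i)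
         (map suc (upTo k))
   ∧ all (λ i → mblk n ρ (2 ℕ.* i) <ᵇ mblk n ρ (2 ℕ.* suc i))
         (map suc (upTo (k ℕ.∸ 1)))

nblk : ℕ → (ℤ → ℕ) → ℕ → ℕ
nblk n ρ i = length (filter (λ s → (+ mblk n ρ i) ℤ.<? s) (block n ρ (i ℕ.∸ 1)))

maj : ℕ → ℕ → (ℤ → ℕ) → ℕ
maj n k ρ = foldr ℕ._+_ 0 (map (λ i → i ℕ.* nblk n ρ i) (map suc (upTo (2 ℕ.* k))))

allLists : ℕ → ℕ → List (List ℕ)
allLists b zero    = [] ∷ []
allLists b (suc l) = concatMap (λ v → map (v ∷_) (allLists b l)) (upTo b)

nth : List ℕ → ℕ → ℕ
nth []       _       = 0
nth (v ∷ _)  zero    = v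
nth (_ ∷ vs) (suc i) = nth vs i

fromValues : ℕ → List ℕ → (ℤ → ℕ)
fromValues n vs x = nth vs ∣ x ℤ.+ (+ n) ∣

-- S_B(⟨n⟩,k): each signed partition appears exactly once (via its
-- standard-form labelling)
signedPartitions : ℕ → ℕ → List (ℤ → ℕ)
signedPartitions n k =
  filter (λ ρ → T? (isStdSignedPartition n k ρ))
    (map (fromValues n) (allLists (suc (2 ℕ.* k)) (suc (2 ℕ.* n))))

{-# OPTIONS --safe #-}

-- A standard-form signed partition of ⟨n+1⟩ with 2k+1 blocks restricts to one
-- of ⟨n⟩, and ±(n+1) always lie in mirror blocks S_b and -S_b. If S_b already meets ⟨n⟩, then
-- the old partition has the same k, no minimum m_j changes, and n+1 > m_{b+1} is the only new
-- element counted by maj: maj grows by b+1 for b < 2k and by 0 for b = 2k. Otherwise {-(n+1)}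
-- and {n+1} are a new last pair S_{2k-1}, S_{2k}, the old partition has k-1 pairs, and maj is
-- unchanged. Summing q^maj over all extensions therefore gives (1 + q[2k]) = [2k+1] times the
-- sum for (n, k) plus the sum for (n, k-1), the recursion defining S_B.
module Submission where

open import Defs
open import Algebra.Bundles using (CommutativeSemiring)
open import Data.Bool.Base using (Bool; true; false; T; not; _∧_; _∨_; if_then_else_)
open import Data.Bool.Properties using (T-∧)
open import Data.Empty using (⊥; ⊥-elim)
open import Data.Integer as ℤ using (ℤ; +_; -[1+_]; -_; ∣_∣)
import Data.Integer.Properties as ℤP
open import Data.List using (List; []; _∷_; map; filter; foldr; length; upTo; applyUpTo; _++_; concatMap)
import Data.List.Properties as LP
open import Data.List.Membership.Propositional using (_∈_)
import Data.List.Membership.Propositional.Properties as ∈P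
open import Data.List.Relation.Unary.All as All using (All; []; _∷_)
import Data.List.Relation.Unary.All.Properties as AllP
open import Data.List.Relation.Unary.Any using (here; there)
open import Data.Nat as ℕ using (ℕ; zero; suc; _≤_; _<_; z≤n; s≤s; _∸_; _≡ᵇ_; _<ᵇ_)
import Data.Nat.Properties as ℕP
open import Data.Nat.ListAction using (sum)
open import Data.Nat.ListAction.Properties using (sum-++)
open import Data.Product using (∃-syntax; _×_; _,_; proj₁; proj₂; uncurry)
open import Data.Sum using (_⊎_; inj₁; inj₂)
open import Data.Unit using (⊤; tt)
open import Function using (_∘_; Equivalence)
open import Relation.Binary.PropositionalEquality
  using (_≡_; _≢_; refl; sym; trans; cong; cong₂; subst; subst₂; module ≡-Reasoning)
open import Relation.Nullary using (¬_; Dec; yes; no)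
open import Relation.Nullary.Decidable using (T?; map′)

applyUpTo-cong : ∀ {A : Set} {f g : ℕ → A} → (∀ i → f i ≡ g i) → ∀ m → applyUpTo f m ≡ applyUpTo g m
applyUpTo-cong f≗g zero    = refl
applyUpTo-cong f≗g (suc m) = cong₂ _∷_ (f≗g 0) (applyUpTo-cong (f≗g ∘ suc) m)

n≤2n : ∀ n → n ≤ 2 ℕ.* n
n≤2n n = ℕP.m≤m+n n (n ℕ.+ 0)

angle-suc : ∀ n → angle (suc n) ≡ -[1+ n ] ∷ (angle n ++ (+ suc n ∷ []))
angle-suc n = begin
  map (shift (suc n)) (upTo (suc (2 ℕ.* suc n)))
    ≡⟨ cong (λ m → map (shift (suc n)) (upTo (suc m))) (ℕP.*-suc 2 n) ⟩
  map (shift (suc n)) (upTo (3 ℕ.+ 2 ℕ.* n))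
    ≡⟨ LP.map-upTo (shift (suc n)) (3 ℕ.+ 2 ℕ.* n) ⟩
  -[1+ n ] ∷ applyUpTo (shift (suc n) ∘ suc) (2 ℕ.+ 2 ℕ.* n)
    ≡⟨ cong (-[1+ n ] ∷_) (sym (LP.applyUpTo-∷ʳ (shift (suc n) ∘ suc) (suc (2 ℕ.* n)))) ⟩
  -[1+ n ] ∷ (applyUpTo (shift (suc n) ∘ suc) (suc (2 ℕ.* n)) ++ (shift (suc n) (2 ℕ.+ 2 ℕ.* n) ∷ []))
    ≡⟨ cong₂ (λ xs y → -[1+ n ] ∷ (xs ++ (y ∷ []))) inner top ⟩
  -[1+ n ] ∷ (angle n ++ (+ suc n ∷ [])) ∎
  where
  open ≡-Reasoning
  shift : ℕ → ℕ → ℤ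
  shift m i = + i ℤ.- + m
  shift-suc : ∀ i → shift (suc n) (suc i) ≡ shift n i
  shift-suc i = trans (ℤP.m-n≡m⊖n (suc i) (suc n)) (trans (ℤP.[1+m]⊖[1+n]≡m⊖n i n) (sym (ℤP.m-n≡m⊖n i n)))
  inner : applyUpTo (shift (suc n) ∘ suc) (suc (2 ℕ.* n)) ≡ angle n
  inner = trans (applyUpTo-cong shift-suc (suc (2 ℕ.* n))) (sym (LP.map-upTo (shift n) (suc (2 ℕ.* n))))
  top : shift (suc n) (2 ℕ.+ 2 ℕ.* n) ≡ + suc n
  top = trans (ℤP.m-n≡m⊖n (2 ℕ.+ 2 ℕ.* n) (suc n))
          (trans (ℤP.⊖-≥ (s≤s (ℕP.m≤n⇒m≤1+n (n≤2n n))))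
            (cong +_ (trans (cong (λ m → suc m ∸ n) (cong (n ℕ.+_) (ℕP.+-identityʳ n))) (ℕP.m+n∸n≡m (suc n) n))))

∣x∣≡1+n⇒ : ∀ x n → ∣ x ∣ ≡ suc n → x ≡ -[1+ n ] ⊎ x ≡ + suc n
∣x∣≡1+n⇒ (+ _)    n refl = inj₂ refl
∣x∣≡1+n⇒ -[1+ m ] n eq   = inj₁ (cong -[1+_] (ℕP.suc-injective eq))

∣x∣≤1+n⇒ : ∀ x n → ∣ x ∣ ≤ suc n → ∣ x ∣ ≤ n ⊎ x ≡ -[1+ n ] ⊎ x ≡ + suc n
∣x∣≤1+n⇒ x n le with ℕP.m≤n⇒m<n∨m≡n le
... | inj₁ (s≤s lt) = inj₁ lt
... | inj₂ eq       = inj₂ (∣x∣≡1+n⇒ x n eq)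

∣-x∣≤ : ∀ x {n} → ∣ x ∣ ≤ n → ∣ - x ∣ ≤ n
∣-x∣≤ x = subst (_≤ _) (sym (ℤP.∣-i∣≡∣i∣ x))

∈-angle⁻ : ∀ n {x} → x ∈ angle n → ∣ x ∣ ≤ n
∈-angle⁻ zero    (here refl) = z≤n
∈-angle⁻ (suc n) x∈ rewrite angle-suc n with x∈
... | here refl = ℕP.≤-refl
... | there x∈′ with ∈P.∈-++⁻ (angle n) x∈′
...   | inj₁ x∈ₙ       = ℕP.m≤n⇒m≤1+n (∈-angle⁻ n x∈ₙ)
...   | inj₂ (here refl) = ℕP.≤-refl

∈-angle⁺ : ∀ n {x} → ∣ x ∣ ≤ n → x ∈ angle n
∈-angle⁺ zero    {+ zero} _ = here refl
∈-angle⁺ (suc n) {x} le rewrite angle-suc n with ∣x∣≤1+n⇒ x n le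
... | inj₁ le′        = there (∈P.∈-++⁺ˡ (∈-angle⁺ n le′))
... | inj₂ (inj₁ refl) = here refl
... | inj₂ (inj₂ refl) = there (∈P.∈-++⁺ʳ (angle n) (here refl))

-- Blocks and their minima

Occurs : ℕ → (ℤ → ℕ) → ℕ → Set
Occurs n ρ j = ∃[ y ] ∣ y ∣ ≤ n × ρ y ≡ j

∈-block⁻ : ∀ n ρ j {y} → y ∈ block n ρ j → ∣ y ∣ ≤ n × ρ y ≡ j
∈-block⁻ n ρ j y∈ = let y∈⟨n⟩ , ρy≡j = ∈P.∈-filter⁻ (λ x → ρ x ℕ.≟ j) y∈ in ∈-angle⁻ n y∈⟨n⟩ , ρy≡j

∈-block⁺ : ∀ n ρ j {y} → ∣ y ∣ ≤ n → ρ y ≡ j → y ∈ block n ρ j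
∈-block⁺ n ρ j le ρy≡j = ∈P.∈-filter⁺ (λ x → ρ x ℕ.≟ j) (∈-angle⁺ n le) ρy≡j

occurs? : ∀ n ρ j → Dec (Occurs n ρ j)
occurs? n ρ j with block n ρ j in eq
... | []    = no λ (y , le , ρy≡j) → case (subst (y ∈_) eq (∈-block⁺ n ρ j le ρy≡j))
  where case : ∀ {y : ℤ} → y ∈ [] → ⊥
        case ()
... | y ∷ _ = yes (y , ∈-block⁻ n ρ j (subst (y ∈_) (sym eq) (here refl)))

minAbs-≤ : ∀ {xs y} → y ∈ xs → minAbs xs ≤ ∣ y ∣
minAbs-≤ {x ∷ xs} (here refl) = foldr-≤-seed ∣ x ∣ xs
  where
  foldr-≤-seed : ∀ a ys → foldr (λ y r → ∣ y ∣ ℕ.⊓ r) a ys ≤ a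
  foldr-≤-seed a []       = ℕP.≤-refl
  foldr-≤-seed a (y ∷ ys) = ℕP.≤-trans (ℕP.m⊓n≤n ∣ y ∣ _) (foldr-≤-seed a ys)
minAbs-≤ {x ∷ xs} (there y∈) = foldr-≤-member ∣ x ∣ xs y∈
  where
  foldr-≤-member : ∀ a ys {y} → y ∈ ys → foldr (λ y r → ∣ y ∣ ℕ.⊓ r) a ys ≤ ∣ y ∣
  foldr-≤-member a (y ∷ ys) (here refl) = ℕP.m⊓n≤m ∣ y ∣ _
  foldr-≤-member a (y ∷ ys) (there y∈) = ℕP.≤-trans (ℕP.m⊓n≤n ∣ y ∣ _) (foldr-≤-member a ys y∈)

minAbs-attained : ∀ {xs y} → y ∈ xs → ∃[ z ] z ∈ xs × minAbs xs ≡ ∣ z ∣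
minAbs-attained {x ∷ xs} _ with foldr-attained ∣ x ∣ xs
  where
  foldr-attained : ∀ a ys → let m = foldr (λ y r → ∣ y ∣ ℕ.⊓ r) a ys in m ≡ a ⊎ ∃[ z ] z ∈ ys × m ≡ ∣ z ∣
  foldr-attained a []       = inj₁ refl
  foldr-attained a (y ∷ ys) with ℕP.⊓-sel ∣ y ∣ (foldr (λ y r → ∣ y ∣ ℕ.⊓ r) a ys) | foldr-attained a ys
  ... | inj₁ eq | _                  = inj₂ (y , here refl , eq)
  ... | inj₂ eq | inj₁ eq′           = inj₁ (trans eq eq′)
  ... | inj₂ eq | inj₂ (z , z∈ , eq′) = inj₂ (z , there z∈ , trans eq eq′)
... | inj₁ eq            = x , here refl , eq
... | inj₂ (z , z∈ , eq) = z , there z∈ , eq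

minAbs-unique : ∀ {xs y m} → y ∈ xs → ∣ y ∣ ≡ m → (∀ {z} → z ∈ xs → m ≤ ∣ z ∣) → minAbs xs ≡ m
minAbs-unique y∈ refl lower with minAbs-attained y∈
... | z , z∈ , eq = ℕP.≤-antisym (minAbs-≤ y∈) (subst (_ ≤_) (sym eq) (lower z∈))

mblk-≤ : ∀ n ρ j → mblk n ρ j ≤ n
mblk-≤ n ρ j with block n ρ j in eq
... | []    = z≤n
... | y ∷ ys = ℕP.≤-trans (minAbs-≤ {y ∷ ys} (here refl))
                 (proj₁ (∈-block⁻ n ρ j (subst (y ∈_) (sym eq) (here refl))))

Occurs-suc : ∀ {n ρ j} → Occurs n ρ j → Occurs (suc n) ρ j
Occurs-suc (y , le , ρy≡j) = y , ℕP.m≤n⇒m≤1+n le , ρy≡j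

mblk-suc-old : ∀ n ρ j → Occurs n ρ j → mblk (suc n) ρ j ≡ mblk n ρ j
mblk-suc-old n ρ j (y , le , ρy≡j) with minAbs-attained (∈-block⁺ n ρ j le ρy≡j)
... | z , z∈ , m≡∣z∣ =
  let ∣z∣≤n , ρz≡j = ∈-block⁻ n ρ j z∈ in
  minAbs-unique (∈-block⁺ (suc n) ρ j (ℕP.m≤n⇒m≤1+n ∣z∣≤n) ρz≡j) (sym m≡∣z∣) lower
  where
  lower : ∀ {x} → x ∈ block (suc n) ρ j → mblk n ρ j ≤ ∣ x ∣
  lower x∈ with ∈-block⁻ (suc n) ρ j x∈
  ... | le′ , ρx≡j with ℕP.m≤n⇒m<n∨m≡n le′
  ...   | inj₁ (s≤s le″) = minAbs-≤ (∈-block⁺ n ρ j le″ ρx≡j)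
  ...   | inj₂ ∣x∣≡1+n   = subst (_ ≤_) (sym ∣x∣≡1+n) (ℕP.m≤n⇒m≤1+n (mblk-≤ n ρ j))

mblk-suc-new : ∀ n ρ j → ¬ Occurs n ρ j → Occurs (suc n) ρ j → mblk (suc n) ρ j ≡ suc n
mblk-suc-new n ρ j new (y , le , ρy≡j) =
  minAbs-unique (∈-block⁺ (suc n) ρ j le ρy≡j) (at-boundary le ρy≡j)
    (λ x∈ → ℕP.≤-reflexive (sym (uncurry at-boundary (∈-block⁻ (suc n) ρ j x∈))))
  where
  at-boundary : ∀ {x} → ∣ x ∣ ≤ suc n → ρ x ≡ j → ∣ x ∣ ≡ suc n
  at-boundary {x} le ρx≡j with ℕP.m≤n⇒m<n∨m≡n le
  ... | inj₁ (s≤s le′) = ⊥-elim (new (x , le′ , ρx≡j))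
  ... | inj₂ eq        = eq

-- The i-th pair of blocks (counting from 0) is {S_{oddIx i}, S_{evenIx i}} = {S_{2i+1}, S_{2i+2}}.
evenIx oddIx : ℕ → ℕ
evenIx i = 2 ℕ.* suc i
oddIx  i = 2 ℕ.* suc i ∸ 1

evenIx≡ : ∀ i → evenIx i ≡ suc (suc (2 ℕ.* i))
evenIx≡ i = ℕP.*-suc 2 i

oddIx≡ : ∀ i → oddIx i ≡ suc (2 ℕ.* i)
oddIx≡ i = cong (_∸ 1) (evenIx≡ i)

evenIx≡suc-oddIx : ∀ i → evenIx i ≡ suc (oddIx i)
evenIx≡suc-oddIx i = trans (evenIx≡ i) (cong suc (sym (oddIx≡ i)))

evenIx-injective : ∀ {i j} → evenIx i ≡ evenIx j → i ≡ j
evenIx-injective {i} {j} eq = ℕP.suc-injective (ℕP.*-cancelˡ-≡ (suc i) (suc j) 2 eq)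

evenIx≢oddIx : ∀ i j → evenIx i ≢ oddIx j
evenIx≢oddIx i j eq = ℕP.even≢odd (suc i) j (trans eq (oddIx≡ j))

evenIx-< : ∀ {i k} → i < k → evenIx i < suc (2 ℕ.* k)
evenIx-< i<k = s≤s (ℕP.*-monoʳ-≤ 2 i<k)

oddIx-< : ∀ {i k} → i < k → oddIx i < suc (2 ℕ.* k)
oddIx-< {i} i<k = ℕP.<-trans (subst (oddIx i <_) (sym (evenIx≡suc-oddIx i)) ℕP.≤-refl) (evenIx-< i<k)

oddIx-<⁻ : ∀ {i k} → oddIx i < suc (2 ℕ.* k) → i < k
oddIx-<⁻ {i} {k} lt = ℕP.*-cancelˡ-< 2 i k (subst (_≤ 2 ℕ.* k) (oddIx≡ i) (ℕP.≤-pred lt))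

evenIx-<⁻ : ∀ {i k} → evenIx i < suc (2 ℕ.* k) → i < k
evenIx-<⁻ {i} lt = oddIx-<⁻ (ℕP.<-trans (subst (oddIx i <_) (sym (evenIx≡suc-oddIx i)) ℕP.≤-refl) lt)

<-top-cases : ∀ {j k} → j < suc (evenIx k) → j < suc (2 ℕ.* k) ⊎ j ≡ oddIx k ⊎ j ≡ evenIx k
<-top-cases {j} {k} (s≤s j≤e) with ℕP.m≤n⇒m<n∨m≡n (subst (j ≤_) (evenIx≡ k) j≤e)
... | inj₂ eq = inj₂ (inj₂ (trans eq (sym (evenIx≡ k))))
... | inj₁ (s≤s j≤o) with ℕP.m≤n⇒m<n∨m≡n j≤o
...   | inj₂ eq = inj₂ (inj₁ (trans eq (sym (oddIx≡ k))))
...   | inj₁ lt = inj₁ lt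

data LabelView : ℕ → Set where
  S₀   : LabelView 0
  odd  : ∀ i → LabelView (oddIx i)
  even : ∀ i → LabelView (evenIx i)

labelView : ∀ j → LabelView j
labelView zero          = S₀
labelView (suc zero)    = odd 0
labelView (suc (suc j)) with labelView j
... | S₀     = even 0
... | odd i  = subst LabelView (step i) (odd (suc i))
  where
  step : ∀ i → oddIx (suc i) ≡ suc (suc (oddIx i))
  step i = trans (oddIx≡ (suc i)) (trans (cong suc (evenIx≡ i)) (cong (suc ∘ suc) (sym (oddIx≡ i))))
... | even i = subst LabelView (step i) (even (suc i))
  where
  step : ∀ i → evenIx (suc i) ≡ suc (suc (evenIx i))
  step i = evenIx≡ (suc i)

-- mirror j is the label of -S_j
mirror : ℕ → ℕ
mirror 0                   = 0
mirror 1                   = 2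
mirror 2                   = 1
mirror (suc (suc (suc j))) = suc (suc (mirror (suc j)))

mirror-oddIx : ∀ i → mirror (oddIx i) ≡ evenIx i
mirror-oddIx i = trans (cong mirror (oddIx≡ i)) (trans (mirror-odd i) (sym (evenIx≡ i)))
  where
  mirror-odd : ∀ i → mirror (suc (2 ℕ.* i)) ≡ suc (suc (2 ℕ.* i))
  mirror-odd zero    = refl
  mirror-odd (suc i) rewrite ℕP.*-suc 2 i = cong (suc ∘ suc) (mirror-odd i)

mirror-evenIx : ∀ i → mirror (evenIx i) ≡ oddIx i
mirror-evenIx i = trans (cong mirror (evenIx≡ i)) (trans (mirror-even i) (sym (oddIx≡ i)))
  where
  mirror-even : ∀ i → mirror (suc (suc (2 ℕ.* i))) ≡ suc (2 ℕ.* i)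
  mirror-even zero    = refl
  mirror-even (suc i) rewrite ℕP.*-suc 2 i = cong (suc ∘ suc) (mirror-even i)

mirror-involutive : ∀ j → mirror (mirror j) ≡ j
mirror-involutive j with labelView j
... | S₀     = refl
... | odd i  = trans (cong mirror (mirror-oddIx i)) (mirror-evenIx i)
... | even i = trans (cong mirror (mirror-evenIx i)) (mirror-oddIx i)

mirror-< : ∀ {j k} → j < suc (2 ℕ.* k) → mirror j < suc (2 ℕ.* k)
mirror-< {j} {k} lt with labelView j
... | S₀     = s≤s z≤n
... | odd i  = subst (_< _) (sym (mirror-oddIx i)) (evenIx-< (oddIx-<⁻ {k = k} lt))
... | even i = subst (_< _) (sym (mirror-evenIx i)) (oddIx-< (evenIx-<⁻ {k = k} lt))

-- Signed partitions in standard form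

T-∧⁻ : ∀ {a b} → T (a ∧ b) → T a × T b
T-∧⁻ = Equivalence.to T-∧

T-∧⁺ : ∀ {a b} → T a → T b → T (a ∧ b)
T-∧⁺ ta tb = Equivalence.from T-∧ (ta , tb)

T-→⁻ : ∀ {a b} → T (not a ∨ b) → T a → T b
T-→⁻ {true} tb _ = tb

T-→⁺ : ∀ {a b} → (T a → T b) → T (not a ∨ b)
T-→⁺ {true}  f = f tt
T-→⁺ {false} _ = tt

all⁻ : ∀ {A : Set} {p : A → Bool} {xs} → T (all p xs) → ∀ {x} → x ∈ xs → T (p x)
all⁻ {xs = _ ∷ _} t (here refl) = proj₁ (T-∧⁻ t)
all⁻ {xs = _ ∷ _} t (there x∈)  = all⁻ (proj₂ (T-∧⁻ t)) x∈

all⁺ : ∀ {A : Set} {p : A → Bool} {xs} → (∀ {x} → x ∈ xs → T (p x)) → T (all p xs)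
all⁺ {xs = []}    _ = tt
all⁺ {xs = _ ∷ _} h = T-∧⁺ (h (here refl)) (all⁺ (h ∘ there))

all-angle⁻ : ∀ {p n} → T (all p (angle n)) → ∀ x → ∣ x ∣ ≤ n → T (p x)
all-angle⁻ {n = n} t x le = all⁻ t (∈-angle⁺ n le)

all-angle⁺ : ∀ {p n} → (∀ x → ∣ x ∣ ≤ n → T (p x)) → T (all p (angle n))
all-angle⁺ {n = n} h = all⁺ λ x∈ → h _ (∈-angle⁻ n x∈)

all-upTo⁻ : ∀ {p m} → T (all p (upTo m)) → ∀ {i} → i < m → T (p i)
all-upTo⁻ t i<m = all⁻ t (∈P.∈-upTo⁺ i<m)

all-upTo⁺ : ∀ {p m} → (∀ {i} → i < m → T (p i)) → T (all p (upTo m))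
all-upTo⁺ h = all⁺ (h ∘ ∈P.∈-upTo⁻)

all-suc-upTo⁻ : ∀ {p m} → T (all p (map suc (upTo m))) → ∀ {i} → i < m → T (p (suc i))
all-suc-upTo⁻ t i<m = all⁻ t (∈P.∈-map⁺ suc (∈P.∈-upTo⁺ i<m))

all-suc-upTo⁺ : ∀ {p m} → (∀ {i} → i < m → T (p (suc i))) → T (all p (map suc (upTo m)))
all-suc-upTo⁺ {p} {m} h = all⁺ λ x∈ → case (∈P.∈-map⁻ suc x∈)
  where case : ∀ {x} → ∃[ i ] i ∈ upTo m × x ≡ suc i → T (p x)
        case (i , i∈ , refl) = h (∈P.∈-upTo⁻ i∈)

≡ᵇ⁻ : ∀ {m n} → T (m ≡ᵇ n) → m ≡ n
≡ᵇ⁻ = ℕP.≡ᵇ⇒≡ _ _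

≡ᵇ⁺ : ∀ {m n} → m ≡ n → T (m ≡ᵇ n)
≡ᵇ⁺ = ℕP.≡⇒≡ᵇ _ _

increasing-chain : ∀ {K} (f : ℕ → ℕ) → (∀ {i} → i < K ∸ 1 → f i < f (suc i)) →
                   ∀ {i j} → i < j → j < K → f i < f j
increasing-chain {suc K} f step {i} {suc j} i<1+j 1+j<K with ℕP.m≤n⇒m<n∨m≡n (ℕP.≤-pred i<1+j)
... | inj₂ refl = step (ℕP.≤-pred 1+j<K)
... | inj₁ i<j  =
  ℕP.<-trans (increasing-chain f step i<j (ℕP.<-trans (ℕP.n<1+n j) 1+j<K)) (step (ℕP.≤-pred 1+j<K))

-- The symmetry conditions S₀ = -S₀ and S_{2i-1} = -S_{2i} of isStdSignedPartition are combined
-- into the single condition ρ(-x) = mirror (ρ x).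
record StdSignedPartition (n k : ℕ) (ρ : ℤ → ℕ) : Set where
  field
    bounded        : ∀ x → ∣ x ∣ ≤ n → ρ x < suc (2 ℕ.* k)
    zero∈S₀        : ρ (+ 0) ≡ 0
    occurs         : ∀ {j} → j < suc (2 ℕ.* k) → Occurs n ρ j
    mirrored       : ∀ x → ∣ x ∣ ≤ n → ρ (- x) ≡ mirror (ρ x)
    min∈even       : ∀ {i} → i < k → ρ (+ mblk n ρ (evenIx i)) ≡ evenIx i
    min-increasing : ∀ {i j} → i < j → j < k → mblk n ρ (evenIx i) < mblk n ρ (evenIx j)

module _ {n k : ℕ} {ρ : ℤ → ℕ} where

  private
    inRange symS₀ : ℤ → Bool
    inRange x = ρ x <ᵇ suc (2 ℕ.* k)
    symS₀ x = not (ρ x ≡ᵇ 0) ∨ (ρ (- x) ≡ᵇ 0)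

    pairAt : ℕ → ℤ → Bool
    pairAt i x = (not (ρ x ≡ᵇ 2 ℕ.* i) ∨ (ρ (- x) ≡ᵇ 2 ℕ.* i ∸ 1))
               ∧ (not (ρ x ≡ᵇ 2 ℕ.* i ∸ 1) ∨ (ρ (- x) ≡ᵇ 2 ℕ.* i))

    nonEmptyBlock pairs minAt minBelowNext : ℕ → Bool
    nonEmptyBlock j = nonEmpty (block n ρ j)
    pairs i = all (pairAt i) (angle n)
    minAt i = ρ (+ mblk n ρ (2 ℕ.* i)) ≡ᵇ 2 ℕ.* i
    minBelowNext i = mblk n ρ (2 ℕ.* i) <ᵇ mblk n ρ (2 ℕ.* suc i)

  toStd : T (isStdSignedPartition n k ρ) → StdSignedPartition n k ρ
  toStd t = record
    { bounded        = λ x le → ℕP.<ᵇ⇒< _ _ (all-angle⁻ {inRange} c₁ x le)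
    ; zero∈S₀        = ≡ᵇ⁻ c₂
    ; occurs         = λ {j} lt → occurs-nonEmpty j (all-upTo⁻ {nonEmptyBlock} c₃ lt)
    ; mirrored       = λ x le → mirrored-from x le refl (labelView (ρ x))
    ; min∈even       = λ lt → ≡ᵇ⁻ (all-suc-upTo⁻ {minAt} c₆ lt)
    ; min-increasing = increasing-chain (λ i → mblk n ρ (evenIx i))
                         (λ lt → ℕP.<ᵇ⇒< _ _ (all-suc-upTo⁻ {minBelowNext} c₇ lt))
    }
    where
    c₁ : T (all inRange (angle n))
    c₁ = proj₁ (T-∧⁻ t)
    t₂ = proj₂ (T-∧⁻ {all inRange (angle n)} t)
    c₂ : T (ρ (+ 0) ≡ᵇ 0)
    c₂ = proj₁ (T-∧⁻ t₂)
    t₃ = proj₂ (T-∧⁻ {ρ (+ 0) ≡ᵇ 0} t₂)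
    c₃ : T (all nonEmptyBlock (upTo (suc (2 ℕ.* k))))
    c₃ = proj₁ (T-∧⁻ t₃)
    t₄ = proj₂ (T-∧⁻ {all nonEmptyBlock (upTo (suc (2 ℕ.* k)))} t₃)
    c₄ : T (all symS₀ (angle n))
    c₄ = proj₁ (T-∧⁻ t₄)
    t₅ = proj₂ (T-∧⁻ {all symS₀ (angle n)} t₄)
    c₅ : T (all pairs (map suc (upTo k)))
    c₅ = proj₁ (T-∧⁻ t₅)
    t₆ = proj₂ (T-∧⁻ {all pairs (map suc (upTo k))} t₅)
    c₆ : T (all minAt (map suc (upTo k)))
    c₆ = proj₁ (T-∧⁻ t₆)
    c₇ : T (all minBelowNext (map suc (upTo (k ∸ 1))))
    c₇ = proj₂ (T-∧⁻ {all minAt (map suc (upTo k))} t₆)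
    occurs-nonEmpty : ∀ j → T (nonEmpty (block n ρ j)) → Occurs n ρ j
    occurs-nonEmpty j _ with block n ρ j in eq
    ... | y ∷ _ = y , ∈-block⁻ n ρ j (subst (y ∈_) (sym eq) (here refl))
    pair : ∀ {i} → i < k → ∀ x → ∣ x ∣ ≤ n → T (pairAt (suc i) x)
    pair {i} i<k = all-angle⁻ {pairAt (suc i)} (all-suc-upTo⁻ {pairs} c₅ i<k)
    label-bound : ∀ x → ∣ x ∣ ≤ n → ∀ {j} → ρ x ≡ j → j < suc (2 ℕ.* k)
    label-bound x le ρx≡j = subst (_< _) ρx≡j (ℕP.<ᵇ⇒< _ _ (all-angle⁻ {inRange} c₁ x le))
    mirrored-from : ∀ x → ∣ x ∣ ≤ n → ∀ {j} → ρ x ≡ j → LabelView j → ρ (- x) ≡ mirror j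
    mirrored-from x le ρx≡j S₀       = ≡ᵇ⁻ (T-→⁻ (all-angle⁻ {symS₀} c₄ x le) (≡ᵇ⁺ ρx≡j))
    mirrored-from x le ρx≡j (odd i)  =
      let pairᵢ = T-∧⁻ (pair (oddIx-<⁻ {i} (label-bound x le ρx≡j)) x le) in
      trans (≡ᵇ⁻ (T-→⁻ (proj₂ pairᵢ) (≡ᵇ⁺ ρx≡j))) (sym (mirror-oddIx i))
    mirrored-from x le ρx≡j (even i) =
      let pairᵢ = T-∧⁻ (pair (evenIx-<⁻ {i} (label-bound x le ρx≡j)) x le) in
      trans (≡ᵇ⁻ (T-→⁻ (proj₁ pairᵢ) (≡ᵇ⁺ ρx≡j))) (sym (mirror-evenIx i))

  fromStd : StdSignedPartition n k ρ → T (isStdSignedPartition n k ρ)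
  fromStd std =
    T-∧⁺ (all-angle⁺ {inRange} λ x le → ℕP.<⇒<ᵇ (bounded x le)) (
    T-∧⁺ (≡ᵇ⁺ zero∈S₀) (
    T-∧⁺ (all-upTo⁺ {nonEmptyBlock} λ lt → nonEmpty-occurs (occurs lt)) (
    T-∧⁺ (all-angle⁺ {symS₀} λ x le → T-→⁺ λ t → ≡ᵇ⁺ (trans (mirrored x le) (cong mirror (≡ᵇ⁻ t)))) (
    T-∧⁺ (all-suc-upTo⁺ {pairs} {k} λ {i} _ → all-angle⁺ {pairAt (suc i)} λ x le →
            T-∧⁺ (T-→⁺ λ t → ≡ᵇ⁺ (trans (mirrored x le) (trans (cong mirror (≡ᵇ⁻ t)) (mirror-evenIx i))))
                 (T-→⁺ λ t → ≡ᵇ⁺ (trans (mirrored x le) (trans (cong mirror (≡ᵇ⁻ t)) (mirror-oddIx i))))) (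
    T-∧⁺ (all-suc-upTo⁺ {minAt} λ lt → ≡ᵇ⁺ (min∈even lt))
         (all-suc-upTo⁺ {minBelowNext} λ lt → ℕP.<⇒<ᵇ (min-increasing ℕP.≤-refl (below-pred lt))))))))
    where
    open StdSignedPartition std
    nonEmpty-occurs : ∀ {j} → Occurs n ρ j → T (nonEmpty (block n ρ j))
    nonEmpty-occurs {j} (y , le , ρy≡j) with block n ρ j | ∈-block⁺ n ρ j le ρy≡j
    ... | _ ∷ _ | _ = tt
    below-pred : ∀ {i m} → i < m ∸ 1 → suc i < m
    below-pred {m = suc m} lt = s≤s lt

std? : ∀ n k ρ → Dec (StdSignedPartition n k ρ)
std? n k ρ = map′ toStd fromStd (T? (isStdSignedPartition n k ρ))

std-level-≮ : ∀ {n k k′ ρ} → StdSignedPartition n k ρ → StdSignedPartition n k′ ρ → ¬ k < k′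
std-level-≮ {k = k} std std′ k<k′ =
  let y , le , ρy≡e = StdSignedPartition.occurs std′ (evenIx-< k<k′) in
  ℕP.<-irrefl refl (evenIx-<⁻ {k} (subst (_< _) ρy≡e (StdSignedPartition.bounded std y le)))

-- The statistic maj

sum₁ : (ℕ → ℕ) → ℕ → ℕ
sum₁ f m = sum (map f (map suc (upTo m)))

sum₁-snoc : ∀ f m → sum₁ f (suc m) ≡ sum₁ f m ℕ.+ f (suc m)
sum₁-snoc f m = begin
  sum (map f (map suc (upTo (suc m))))
    ≡⟨ cong (λ xs → sum (map f (map suc xs))) (sym (LP.upTo-∷ʳ m)) ⟩
  sum (map f (map suc (upTo m ++ (m ∷ []))))
    ≡⟨ cong (λ xs → sum (map f xs)) (LP.map-++ suc (upTo m) (m ∷ [])) ⟩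
  sum (map f (map suc (upTo m) ++ (suc m ∷ [])))
    ≡⟨ cong sum (LP.map-++ f (map suc (upTo m)) (suc m ∷ [])) ⟩
  sum (map f (map suc (upTo m)) ++ (f (suc m) ∷ []))
    ≡⟨ sum-++ (map f (map suc (upTo m))) (f (suc m) ∷ []) ⟩
  sum₁ f m ℕ.+ (f (suc m) ℕ.+ 0)
    ≡⟨ cong (sum₁ f m ℕ.+_) (ℕP.+-identityʳ (f (suc m))) ⟩
  sum₁ f m ℕ.+ f (suc m) ∎
  where open ≡-Reasoning

sum₁-cong : ∀ {f g} m → (∀ {i} → i < m → f (suc i) ≡ g (suc i)) → sum₁ f m ≡ sum₁ g m
sum₁-cong zero h = refl
sum₁-cong {f} {g} (suc m) h =
  trans (sum₁-snoc f m) (trans (cong₂ ℕ._+_ (sum₁-cong m (h ∘ ℕP.m<n⇒m<1+n)) (h ℕP.≤-refl)) (sym (sum₁-snoc g m)))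

sum₁-+ : ∀ f g m → sum₁ (λ i → f i ℕ.+ g i) m ≡ sum₁ f m ℕ.+ sum₁ g m
sum₁-+ f g zero = refl
sum₁-+ f g (suc m) = begin
  sum₁ (λ i → f i ℕ.+ g i) (suc m)
    ≡⟨ sum₁-snoc _ m ⟩
  sum₁ (λ i → f i ℕ.+ g i) m ℕ.+ (f (suc m) ℕ.+ g (suc m))
    ≡⟨ cong (ℕ._+ (f (suc m) ℕ.+ g (suc m))) (sum₁-+ f g m) ⟩
  sum₁ f m ℕ.+ sum₁ g m ℕ.+ (f (suc m) ℕ.+ g (suc m))
    ≡⟨ +-interchange (sum₁ f m) (sum₁ g m) _ _ ⟩
  sum₁ f m ℕ.+ f (suc m) ℕ.+ (sum₁ g m ℕ.+ g (suc m))
    ≡⟨ sym (cong₂ ℕ._+_ (sum₁-snoc f m) (sum₁-snoc g m)) ⟩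
  sum₁ f (suc m) ℕ.+ sum₁ g (suc m) ∎
  where
  open ≡-Reasoning
  open import Algebra.Properties.CommutativeSemigroup ℕP.+-commutativeSemigroup
    using () renaming (interchange to +-interchange)

indicator : ℕ → ℕ → ℕ
indicator b j = if b ≡ᵇ j then 1 else 0

indicator-≢ : ∀ {b j} → b ≢ j → indicator b j ≡ 0
indicator-≢ {b} {j} b≢j with b ≡ᵇ j in eq
... | true  = ⊥-elim (b≢j (≡ᵇ⁻ (subst T (sym eq) tt)))
... | false = refl

indicator-refl : ∀ b → indicator b b ≡ 1
indicator-refl b with b ≡ᵇ b in eq
... | true  = refl
... | false = ⊥-elim (subst T eq (≡ᵇ⁺ {b} refl))

sum₁-indicator-≥ : ∀ b m → m ≤ b → sum₁ (λ i → i ℕ.* indicator b (i ∸ 1)) m ≡ 0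
sum₁-indicator-≥ b zero    _   = refl
sum₁-indicator-≥ b (suc m) m<b = begin
  sum₁ (λ i → i ℕ.* indicator b (i ∸ 1)) (suc m)            ≡⟨ sum₁-snoc _ m ⟩
  sum₁ (λ i → i ℕ.* indicator b (i ∸ 1)) m ℕ.+ suc m ℕ.* indicator b m
    ≡⟨ cong₂ (λ s t → s ℕ.+ suc m ℕ.* t) (sum₁-indicator-≥ b m (ℕP.<⇒≤ m<b)) (indicator-≢ (ℕP.>⇒≢ m<b)) ⟩
  suc m ℕ.* 0                                               ≡⟨ ℕP.*-zeroʳ (suc m) ⟩
  0 ∎
  where open ≡-Reasoning

sum₁-indicator-< : ∀ b m → b < m → sum₁ (λ i → i ℕ.* indicator b (i ∸ 1)) m ≡ suc b
sum₁-indicator-< b (suc m) (s≤s b≤m) with ℕP.m≤n⇒m<n∨m≡n b≤m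
... | inj₁ b<m = begin
  sum₁ (λ i → i ℕ.* indicator b (i ∸ 1)) (suc m)            ≡⟨ sum₁-snoc _ m ⟩
  sum₁ (λ i → i ℕ.* indicator b (i ∸ 1)) m ℕ.+ suc m ℕ.* indicator b m
    ≡⟨ cong₂ (λ s t → s ℕ.+ suc m ℕ.* t) (sum₁-indicator-< b m b<m) (indicator-≢ (ℕP.<⇒≢ b<m)) ⟩
  suc b ℕ.+ suc m ℕ.* 0                                     ≡⟨ cong (suc b ℕ.+_) (ℕP.*-zeroʳ (suc m)) ⟩
  suc b ℕ.+ 0                                               ≡⟨ ℕP.+-identityʳ (suc b) ⟩
  suc b ∎
  where open ≡-Reasoning
... | inj₂ refl = begin
  sum₁ (λ i → i ℕ.* indicator b (i ∸ 1)) (suc b)            ≡⟨ sum₁-snoc _ b ⟩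
  sum₁ (λ i → i ℕ.* indicator b (i ∸ 1)) b ℕ.+ suc b ℕ.* indicator b b
    ≡⟨ cong₂ (λ s t → s ℕ.+ suc b ℕ.* t) (sum₁-indicator-≥ b b ℕP.≤-refl) (indicator-refl b) ⟩
  suc b ℕ.* 1                                               ≡⟨ ℕP.*-identityʳ (suc b) ⟩
  suc b ∎
  where open ≡-Reasoning

count : ℕ → List ℤ → ℕ
count m xs = length (filter (λ s → + m ℤ.<? s) xs)

count-++ : ∀ m xs ys → count m (xs ++ ys) ≡ count m xs ℕ.+ count m ys
count-++ m xs ys = trans (cong length (LP.filter-++ (λ s → + m ℤ.<? s) xs ys)) (LP.length-++ (filter _ xs))

count-≤ : ∀ m xs → (∀ {y} → y ∈ xs → ∣ y ∣ ≤ m) → count m xs ≡ 0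
count-≤ m []       _ = refl
count-≤ m (y ∷ xs) h with + m ℤ.<? y
... | no _ = count-≤ m xs (h ∘ there)
count-≤ m (+ j ∷ xs) h | yes (ℤ.+<+ m<j) = ⊥-elim (ℕP.<⇒≱ m<j (h (here refl)))

nblk-boundary : ∀ N ρ i → mblk N ρ i ≡ N → nblk N ρ i ≡ 0
nblk-boundary N ρ i m≡N =
  trans (cong (λ m → count m (block N ρ (i ∸ 1))) m≡N) (count-≤ N _ (proj₁ ∘ ∈-block⁻ N ρ (i ∸ 1)))

maj-suc-level : ∀ N k ρ → maj N (suc k) ρ ≡
  maj N k ρ ℕ.+ oddIx k ℕ.* nblk N ρ (oddIx k) ℕ.+ evenIx k ℕ.* nblk N ρ (evenIx k)
maj-suc-level N k ρ = begin
  sum₁ f (2 ℕ.* suc k)                         ≡⟨ cong (sum₁ f) (evenIx≡ k) ⟩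
  sum₁ f (suc (suc (2 ℕ.* k)))                 ≡⟨ sum₁-snoc f (suc (2 ℕ.* k)) ⟩
  sum₁ f (suc (2 ℕ.* k)) ℕ.+ f (suc (suc (2 ℕ.* k)))
    ≡⟨ cong₂ ℕ._+_ (sum₁-snoc f (2 ℕ.* k)) (cong f (sym (evenIx≡ k))) ⟩
  sum₁ f (2 ℕ.* k) ℕ.+ f (suc (2 ℕ.* k)) ℕ.+ f (evenIx k)
    ≡⟨ cong (λ j → sum₁ f (2 ℕ.* k) ℕ.+ f j ℕ.+ f (evenIx k)) (sym (oddIx≡ k)) ⟩
  maj N k ρ ℕ.+ f (oddIx k) ℕ.+ f (evenIx k) ∎
  where
  open ≡-Reasoning
  f : ℕ → ℕ
  f i = i ℕ.* nblk N ρ i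

Agree : ℕ → (ℤ → ℕ) → (ℤ → ℕ) → Set
Agree n ρ σ = ∀ x → ∣ x ∣ ≤ n → ρ x ≡ σ x

block-cong : ∀ {n ρ σ} → Agree n ρ σ → ∀ j → block n ρ j ≡ block n σ j
block-cong {n} {ρ} {σ} agree j = filter-cong (angle n) (λ x∈ → agree _ (∈-angle⁻ n x∈))
  where
  filter-cong : ∀ xs → (∀ {x} → x ∈ xs → ρ x ≡ σ x) →
                filter (λ x → ρ x ℕ.≟ j) xs ≡ filter (λ x → σ x ℕ.≟ j) xs
  filter-cong []       _ = refl
  filter-cong (x ∷ xs) h with ρ x ≡ᵇ j | σ x ≡ᵇ j | cong (_≡ᵇ j) (h (here refl))
  ... | true  | true  | _ = cong (x ∷_) (filter-cong xs (h ∘ there))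
  ... | false | false | _ = filter-cong xs (h ∘ there)

mblk-cong : ∀ {n ρ σ} → Agree n ρ σ → ∀ j → mblk n ρ j ≡ mblk n σ j
mblk-cong agree j = cong minAbs (block-cong agree j)

maj-cong : ∀ {n ρ σ} → Agree n ρ σ → ∀ k → maj n k ρ ≡ maj n k σ
maj-cong agree k = sum₁-cong (2 ℕ.* k) λ {i} _ →
  cong (suc i ℕ.*_) (cong₂ count (mblk-cong agree (suc i)) (block-cong agree i))

std-cong : ∀ {n k ρ σ} → Agree n ρ σ → StdSignedPartition n k ρ → StdSignedPartition n k σ
std-cong {n} {k} {ρ} {σ} agree std = record
  { bounded        = λ x le → subst (_< _) (agree x le) (bounded x le)
  ; zero∈S₀        = trans (sym (agree (+ 0) z≤n)) zero∈S₀
  ; occurs         = λ lt → let y , le , ρy≡j = occurs lt in y , le , trans (sym (agree y le)) ρy≡j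
  ; mirrored       = λ x le →
      trans (sym (agree (- x) (∣-x∣≤ x le))) (trans (mirrored x le) (cong mirror (agree x le)))
  ; min∈even       = λ {i} lt → trans (cong (σ ∘ +_) (sym (mblk-cong agree (evenIx i))))
                                      (trans (sym (agree _ (mblk-≤ n ρ (evenIx i)))) (min∈even lt))
  ; min-increasing = λ {i} {j} i<j j<k →
      subst₂ _<_ (mblk-cong agree (evenIx i)) (mblk-cong agree (evenIx j)) (min-increasing i<j j<k)
  }
  where open StdSignedPartition std

nth-++ˡ : ∀ xs ys {i} → i < length xs → nth (xs ++ ys) i ≡ nth xs i
nth-++ˡ (x ∷ xs) ys {zero}  _        = refl
nth-++ˡ (x ∷ xs) ys {suc i} (s≤s lt) = nth-++ˡ xs ys lt

nth-length : ∀ xs b ys → nth (xs ++ (b ∷ ys)) (length xs) ≡ b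
nth-length []       b ys = refl
nth-length (x ∷ xs) b ys = nth-length xs b ys

All-nth : ∀ {P : ℕ → Set} vs → (∀ {i} → i < length vs → P (nth vs i)) → All P vs
All-nth []       h = []
All-nth (v ∷ vs) h = h (s≤s z≤n) ∷ All-nth vs (h ∘ s≤s)

∣x+n∣≤ : ∀ n x → ∣ x ∣ ≤ n → ∣ x ℤ.+ + n ∣ < suc (2 ℕ.* n)
∣x+n∣≤ n (+ j)    le = s≤s (ℕP.+-mono-≤ le (ℕP.m≤m+n n 0))
∣x+n∣≤ n -[1+ j ] le rewrite ℤP.⊖-≥ le = s≤s (ℕP.≤-trans (ℕP.m∸n≤m n (suc j)) (ℕP.m≤m+n n (n ℕ.+ 0)))

∣x+1+n∣≡ : ∀ n x → ∣ x ∣ ≤ n → ∣ x ℤ.+ + suc n ∣ ≡ suc ∣ x ℤ.+ + n ∣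
∣x+1+n∣≡ n (+ j)    _  = ℕP.+-suc j n
∣x+1+n∣≡ n -[1+ j ] le rewrite ℤP.⊖-≥ (ℕP.m≤n⇒m≤1+n le) | ℤP.⊖-≥ le = ℕP.+-∸-assoc 1 le

module _ (n : ℕ) (a b : ℕ) (mid : List ℕ) where

  withEnds : ℤ → ℕ
  withEnds = fromValues (suc n) (a ∷ (mid ++ (b ∷ [])))

  withEnds-left : withEnds -[1+ n ] ≡ a
  withEnds-left = cong (nth (a ∷ (mid ++ (b ∷ [])))) (cong ∣_∣ (ℤP.n⊖n≡0 (suc n)))

  module _ (len : length mid ≡ suc (2 ℕ.* n)) where

    withEnds-right : withEnds (+ suc n) ≡ b
    withEnds-right =
      trans (cong (nth (mid ++ (b ∷ []))) (trans (ℕP.+-suc n n) (trans (cong (suc ∘ (n ℕ.+_)) n≡n+0) (sym len))))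
            (nth-length mid b [])
      where n≡n+0 = sym (ℕP.+-identityʳ n)

    withEnds-inner : Agree n withEnds (fromValues n mid)
    withEnds-inner x le =
      trans (cong (nth (a ∷ (mid ++ (b ∷ [])))) (∣x+1+n∣≡ n x le))
            (nth-++ˡ mid (b ∷ []) (subst (_ <_) (sym len) (∣x+n∣≤ n x le)))

fromValues-bounded : ∀ n k vs → length vs ≡ suc (2 ℕ.* n) → StdSignedPartition n k (fromValues n vs) →
                     All (_< suc (2 ℕ.* k)) vs
fromValues-bounded n k vs len std = All-nth vs λ {i} lt →
  let x = + i ℤ.- + n
      x∈ = subst (x ∈_) (sym (LP.map-upTo (λ i → + i ℤ.- + n) (suc (2 ℕ.* n))))
                 (∈P.∈-applyUpTo⁺ (λ i → + i ℤ.- + n) (subst (i <_) len lt))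
  in subst (_< _) (cong (nth vs) (x+n≡i i)) (StdSignedPartition.bounded std x (∈-angle⁻ n x∈))
  where
  x+n≡i : ∀ i → ∣ (+ i ℤ.- + n) ℤ.+ + n ∣ ≡ i
  x+n≡i i = cong ∣_∣ (trans (ℤP.+-assoc (+ i) (- + n) (+ n))
                            (trans (cong (ℤ._+_ (+ i)) (ℤP.+-inverseˡ (+ n))) (ℤP.+-identityʳ (+ i))))

-- Extending a labelling from ⟨n⟩ to ⟨n+1⟩

module Extension (n : ℕ) (ρ : ℤ → ℕ) where

  left right : ℕ
  left  = ρ -[1+ n ]
  right = ρ (+ suc n)

  Occurs-suc⁻ : ∀ {j} → Occurs (suc n) ρ j → Occurs n ρ j ⊎ left ≡ j ⊎ right ≡ j
  Occurs-suc⁻ (y , le , ρy≡j) with ∣x∣≤1+n⇒ y n le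
  ... | inj₁ le′         = inj₁ (y , le′ , ρy≡j)
  ... | inj₂ (inj₁ refl) = inj₂ (inj₁ ρy≡j)
  ... | inj₂ (inj₂ refl) = inj₂ (inj₂ ρy≡j)

  endpoints-mirrored : ∀ {k} → StdSignedPartition (suc n) k ρ → left ≡ mirror right
  endpoints-mirrored std = StdSignedPartition.mirrored std (+ suc n) ℕP.≤-refl

  mirrored-suc : (∀ x → ∣ x ∣ ≤ n → ρ (- x) ≡ mirror (ρ x)) → left ≡ mirror right →
                 ∀ x → ∣ x ∣ ≤ suc n → ρ (- x) ≡ mirror (ρ x)
  mirrored-suc mirrored l≡r x le with ∣x∣≤1+n⇒ x n le
  ... | inj₁ le′         = mirrored x le′
  ... | inj₂ (inj₁ refl) = trans (sym (mirror-involutive right)) (cong mirror (sym l≡r))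
  ... | inj₂ (inj₂ refl) = l≡r

  min∈even-suc : ∀ {i} → Occurs n ρ (evenIx i) → ρ (+ mblk n ρ (evenIx i)) ≡ evenIx i →
                 ρ (+ mblk (suc n) ρ (evenIx i)) ≡ evenIx i
  min∈even-suc {i} occ = subst (λ m → ρ (+ m) ≡ evenIx i) (sym (mblk-suc-old n ρ (evenIx i) occ))

  min-increasing-suc : ∀ {i j} → Occurs n ρ (evenIx i) → Occurs n ρ (evenIx j) →
                       mblk n ρ (evenIx i) < mblk n ρ (evenIx j) →
                       mblk (suc n) ρ (evenIx i) < mblk (suc n) ρ (evenIx j)
  min-increasing-suc {i} {j} occᵢ occⱼ =
    subst₂ _<_ (sym (mblk-suc-old n ρ (evenIx i) occᵢ)) (sym (mblk-suc-old n ρ (evenIx j) occⱼ))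

  extend : ∀ {k} → StdSignedPartition n k ρ → right < suc (2 ℕ.* k) → left ≡ mirror right →
           StdSignedPartition (suc n) k ρ
  extend {k} std right< l≡r = record
    { bounded        = bounded′
    ; zero∈S₀        = zero∈S₀
    ; occurs         = Occurs-suc ∘ occurs
    ; mirrored       = mirrored-suc mirrored l≡r
    ; min∈even       = λ lt → min∈even-suc (occurs (evenIx-< lt)) (min∈even lt)
    ; min-increasing = λ i<j j<k →
        min-increasing-suc (occurs (evenIx-< (ℕP.<-trans i<j j<k))) (occurs (evenIx-< j<k)) (min-increasing i<j j<k)
    }
    where
    open StdSignedPartition std
    bounded′ : ∀ x → ∣ x ∣ ≤ suc n → ρ x < suc (2 ℕ.* k)
    bounded′ x le with ∣x∣≤1+n⇒ x n le
    ... | inj₁ le′         = bounded x le′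
    ... | inj₂ (inj₁ refl) = subst (_< _) (sym l≡r) (mirror-< {k = k} right<)
    ... | inj₂ (inj₂ refl) = right<

  extend-newPair : ∀ {k} → StdSignedPartition n k ρ → right ≡ evenIx k → left ≡ mirror right →
                   StdSignedPartition (suc n) (suc k) ρ
  extend-newPair {k} std r≡e l≡r = record
    { bounded        = bounded′
    ; zero∈S₀        = zero∈S₀
    ; occurs         = occurs′
    ; mirrored       = mirrored-suc mirrored l≡r
    ; min∈even       = min∈even′
    ; min-increasing = min-increasing′
    }
    where
    open StdSignedPartition std
    l≡o : left ≡ oddIx k
    l≡o = trans l≡r (trans (cong mirror r≡e) (mirror-evenIx k))
    new : ¬ Occurs n ρ (evenIx k)
    new (y , le , ρy≡e) = ℕP.<-irrefl refl (evenIx-<⁻ {k} (subst (_< _) ρy≡e (bounded y le)))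
    mblk-new : mblk (suc n) ρ (evenIx k) ≡ suc n
    mblk-new = mblk-suc-new n ρ (evenIx k) new (+ suc n , ℕP.≤-refl , r≡e)
    widen : ∀ {j} → j < suc (2 ℕ.* k) → j < suc (2 ℕ.* suc k)
    widen lt = ℕP.<-≤-trans lt (s≤s (ℕP.*-monoʳ-≤ 2 (ℕP.n≤1+n k)))
    bounded′ : ∀ x → ∣ x ∣ ≤ suc n → ρ x < suc (2 ℕ.* suc k)
    bounded′ x le with ∣x∣≤1+n⇒ x n le
    ... | inj₁ le′         = widen (bounded x le′)
    ... | inj₂ (inj₁ refl) = subst (_< _) (sym l≡o) (oddIx-< ℕP.≤-refl)
    ... | inj₂ (inj₂ refl) = subst (_< _) (sym r≡e) (evenIx-< ℕP.≤-refl)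
    occurs′ : ∀ {j} → j < suc (2 ℕ.* suc k) → Occurs (suc n) ρ j
    occurs′ lt with <-top-cases lt
    ... | inj₁ lt′         = Occurs-suc (occurs lt′)
    ... | inj₂ (inj₁ refl) = -[1+ n ] , ℕP.≤-refl , l≡o
    ... | inj₂ (inj₂ refl) = + suc n , ℕP.≤-refl , r≡e
    min∈even′ : ∀ {i} → i < suc k → ρ (+ mblk (suc n) ρ (evenIx i)) ≡ evenIx i
    min∈even′ (s≤s i≤k) with ℕP.m≤n⇒m<n∨m≡n i≤k
    ... | inj₁ i<k = min∈even-suc (occurs (evenIx-< i<k)) (min∈even i<k)
    ... | inj₂ refl = subst (λ m → ρ (+ m) ≡ evenIx k) (sym mblk-new) r≡e
    min-increasing′ : ∀ {i j} → i < j → j < suc k → mblk (suc n) ρ (evenIx i) < mblk (suc n) ρ (evenIx j)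
    min-increasing′ i<j (s≤s j≤k) with ℕP.m≤n⇒m<n∨m≡n j≤k
    ... | inj₁ j<k  = min-increasing-suc (occurs (evenIx-< (ℕP.<-trans i<j j<k))) (occurs (evenIx-< j<k))
                                         (min-increasing i<j j<k)
    ... | inj₂ refl = subst₂ _<_ (sym (mblk-suc-old n ρ _ (occurs (evenIx-< i<j)))) (sym mblk-new)
                                 (s≤s (mblk-≤ n ρ _))

  restrict : ∀ {K K′} → StdSignedPartition (suc n) K ρ → K′ ≤ K →
             (∀ x → ∣ x ∣ ≤ n → ρ x < suc (2 ℕ.* K′)) → (∀ {i} → i < K′ → Occurs n ρ (evenIx i)) →
             StdSignedPartition n K′ ρ
  restrict {K} {K′} std K′≤K bounded′ evens = record
    { bounded        = bounded′
    ; zero∈S₀        = zero∈S₀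
    ; occurs         = λ lt → occurs′ lt (labelView _)
    ; mirrored       = λ x le → mirrored x (ℕP.m≤n⇒m≤1+n le)
    ; min∈even       = λ lt → subst (λ m → ρ (+ m) ≡ _) (mblk-suc-old n ρ _ (evens lt)) (min∈even (widen lt))
    ; min-increasing = λ i<j j<K′ →
        subst₂ _<_ (mblk-suc-old n ρ _ (evens (ℕP.<-trans i<j j<K′))) (mblk-suc-old n ρ _ (evens j<K′))
          (min-increasing i<j (widen j<K′))
    }
    where
    open StdSignedPartition std
    widen : ∀ {i} → i < K′ → i < K
    widen lt = ℕP.<-≤-trans lt K′≤K
    occurs′ : ∀ {j} → j < suc (2 ℕ.* K′) → LabelView j → Occurs n ρ j
    occurs′ _  S₀       = + 0 , z≤n , zero∈S₀
    occurs′ lt (even i) = evens (evenIx-<⁻ lt)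
    occurs′ lt (odd i)  =
      let y , le , ρy≡e = evens (oddIx-<⁻ {i} lt) in
      - y , ∣-x∣≤ y le , trans (mirrored y (ℕP.m≤n⇒m≤1+n le)) (trans (cong mirror ρy≡e) (mirror-evenIx i))

  restrict-or-newPair : ∀ {k} → StdSignedPartition (suc n) k ρ →
    StdSignedPartition n k ρ ⊎ ∃[ k′ ] k ≡ suc k′ × right ≡ evenIx k′ × StdSignedPartition n k′ ρ
  restrict-or-newPair {zero} std =
    inj₁ (restrict std ℕP.≤-refl (λ x le → StdSignedPartition.bounded std x (ℕP.m≤n⇒m≤1+n le)) λ ())
  restrict-or-newPair {suc k} std with occurs? n ρ (evenIx k)
  ... | yes old = inj₁ (restrict std ℕP.≤-refl (λ x le → bounded x (ℕP.m≤n⇒m≤1+n le)) evens)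
    where
    open StdSignedPartition std
    evens : ∀ {i} → i < suc k → Occurs n ρ (evenIx i)
    evens {i} (s≤s i≤k) with occurs? n ρ (evenIx i) | ℕP.m≤n⇒m<n∨m≡n i≤k
    ... | yes occ | _         = occ
    ... | no _    | inj₂ refl = old
    ... | no new  | inj₁ i<k  = ⊥-elim (ℕP.<⇒≱ too-late (ℕP.m≤n⇒m≤1+n (mblk-≤ n ρ (evenIx k))))
      where
      -- an even block first met at n+1 has minimum n+1, above that of the last even block
      too-late : suc n < mblk n ρ (evenIx k)
      too-late = subst₂ _<_ (mblk-suc-new n ρ _ new (occurs (evenIx-< (ℕP.≤-trans i<k (ℕP.n≤1+n k)))))
                            (mblk-suc-old n ρ _ old)
                            (min-increasing i<k ℕP.≤-refl)
  ... | no new = inj₂ (k , refl , r≡e , restrict std (ℕP.n≤1+n k) bounded′ evens)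
    where
    open StdSignedPartition std
    r≡e : right ≡ evenIx k
    r≡e = subst (λ m → ρ (+ m) ≡ evenIx k) (mblk-suc-new n ρ _ new (occurs (evenIx-< ℕP.≤-refl)))
                (min∈even ℕP.≤-refl)
    l≡o : left ≡ oddIx k
    l≡o = trans (endpoints-mirrored std) (trans (cong mirror r≡e) (mirror-evenIx k))
    bounded′ : ∀ x → ∣ x ∣ ≤ n → ρ x < suc (2 ℕ.* k)
    bounded′ x le with <-top-cases (bounded x (ℕP.m≤n⇒m≤1+n le))
    ... | inj₁ lt = lt
    ... | inj₂ (inj₁ ρx≡o) =
      ⊥-elim (new (- x , ∣-x∣≤ x le ,
                   trans (mirrored x (ℕP.m≤n⇒m≤1+n le)) (trans (cong mirror ρx≡o) (mirror-oddIx k))))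
    ... | inj₂ (inj₂ ρx≡e) = ⊥-elim (new (x , le , ρx≡e))
    evens : ∀ {i} → i < k → Occurs n ρ (evenIx i)
    evens {i} i<k with Occurs-suc⁻ (occurs (evenIx-< (ℕP.≤-trans i<k (ℕP.n≤1+n k))))
    ... | inj₁ occ        = occ
    ... | inj₂ (inj₁ l≡e) = ⊥-elim (evenIx≢oddIx i k (trans (sym l≡e) l≡o))
    ... | inj₂ (inj₂ r≡eᵢ) = ⊥-elim (ℕP.<-irrefl (evenIx-injective (trans (sym r≡eᵢ) r≡e)) i<k)

  count-block-suc : ∀ m j → m ≤ n → count m (block (suc n) ρ j) ≡ count m (block n ρ j) ℕ.+ indicator right j
  count-block-suc m j m≤n = begin
    count m (filter P (angle (suc n)))
      ≡⟨ cong (count m ∘ filter P) (angle-suc n) ⟩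
    count m (filter P (-[1+ n ] ∷ (angle n ++ (+ suc n ∷ []))))
      ≡⟨ drop-left ⟩
    count m (filter P (angle n ++ (+ suc n ∷ [])))
      ≡⟨ cong (count m) (LP.filter-++ P (angle n) (+ suc n ∷ [])) ⟩
    count m (block n ρ j ++ filter P (+ suc n ∷ []))
      ≡⟨ count-++ m (block n ρ j) _ ⟩
    count m (block n ρ j) ℕ.+ count m (filter P (+ suc n ∷ []))
      ≡⟨ cong (count m (block n ρ j) ℕ.+_) count-right ⟩
    count m (block n ρ j) ℕ.+ indicator right j ∎
    where
    open ≡-Reasoning
    P : (x : ℤ) → Dec (ρ x ≡ j)
    P x = ρ x ℕ.≟ j
    drop-left : count m (filter P (-[1+ n ] ∷ (angle n ++ (+ suc n ∷ [])))) ≡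
                count m (filter P (angle n ++ (+ suc n ∷ [])))
    drop-left with left ≡ᵇ j
    ... | true  = refl
    ... | false = refl
    count-right : count m (filter P (+ suc n ∷ [])) ≡ indicator right j
    count-right with right ≡ᵇ j
    ... | false = refl
    ... | true with m <ᵇ suc n in m<ᵇ1+n
    ...   | true  = refl
    ...   | false = ⊥-elim (subst T m<ᵇ1+n (ℕP.<⇒<ᵇ (s≤s m≤n)))

  nblk-suc-old : ∀ i → Occurs n ρ i → nblk (suc n) ρ i ≡ nblk n ρ i ℕ.+ indicator right (i ∸ 1)
  nblk-suc-old i occ =
    trans (cong (λ m → count m (block (suc n) ρ (i ∸ 1))) (mblk-suc-old n ρ i occ))
          (count-block-suc (mblk n ρ i) (i ∸ 1) (mblk-≤ n ρ i))

  maj-extend : ∀ {k} → StdSignedPartition n k ρ →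
               maj (suc n) k ρ ≡ maj n k ρ ℕ.+ sum₁ (λ i → i ℕ.* indicator right (i ∸ 1)) (2 ℕ.* k)
  maj-extend {k} std = trans (sum₁-cong (2 ℕ.* k) step) (sum₁-+ (λ i → i ℕ.* nblk n ρ i) _ (2 ℕ.* k))
    where
    step : ∀ {i} → i < 2 ℕ.* k →
           suc i ℕ.* nblk (suc n) ρ (suc i) ≡ suc i ℕ.* nblk n ρ (suc i) ℕ.+ suc i ℕ.* indicator right i
    step {i} lt = trans (cong (suc i ℕ.*_) (nblk-suc-old (suc i) (StdSignedPartition.occurs std (s≤s lt))))
                        (ℕP.*-distribˡ-+ (suc i) (nblk n ρ (suc i)) (indicator right i))

  maj-extend-< : ∀ {k} → StdSignedPartition n k ρ → right < 2 ℕ.* k →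
                 maj (suc n) k ρ ≡ maj n k ρ ℕ.+ suc right
  maj-extend-< {k} std r<2k =
    trans (maj-extend std) (cong (maj n k ρ ℕ.+_) (sum₁-indicator-< right (2 ℕ.* k) r<2k))

  maj-extend-top : ∀ {k} → StdSignedPartition n k ρ → 2 ℕ.* k ≤ right → maj (suc n) k ρ ≡ maj n k ρ
  maj-extend-top {k} std 2k≤r =
    trans (maj-extend std) (trans (cong (maj n k ρ ℕ.+_) (sum₁-indicator-≥ right (2 ℕ.* k) 2k≤r)) (ℕP.+-identityʳ _))

  maj-extend-newPair : ∀ {k} → StdSignedPartition n k ρ → right ≡ evenIx k → left ≡ mirror right →
                       maj (suc n) (suc k) ρ ≡ maj n k ρ
  maj-extend-newPair {k} std r≡e l≡r = begin
    maj (suc n) (suc k) ρ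
      ≡⟨ maj-suc-level (suc n) k ρ ⟩
    maj (suc n) k ρ ℕ.+ oddIx k ℕ.* nblk (suc n) ρ (oddIx k) ℕ.+ evenIx k ℕ.* nblk (suc n) ρ (evenIx k)
      ≡⟨ cong₂ (λ s t → maj (suc n) k ρ ℕ.+ oddIx k ℕ.* s ℕ.+ evenIx k ℕ.* t)
               (new-block (oddIx k) 2k<oddIx (-[1+ n ] , ℕP.≤-refl , l≡o))
               (new-block (evenIx k) (ℕP.<-trans 2k<oddIx (subst (oddIx k <_) (sym (evenIx≡suc-oddIx k)) ℕP.≤-refl))
                                     (+ suc n , ℕP.≤-refl , r≡e)) ⟩
    maj (suc n) k ρ ℕ.+ oddIx k ℕ.* 0 ℕ.+ evenIx k ℕ.* 0
      ≡⟨ cong₂ (λ s t → maj (suc n) k ρ ℕ.+ s ℕ.+ t) (ℕP.*-zeroʳ (oddIx k)) (ℕP.*-zeroʳ (evenIx k)) ⟩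
    maj (suc n) k ρ ℕ.+ 0 ℕ.+ 0
      ≡⟨ trans (ℕP.+-identityʳ _) (ℕP.+-identityʳ _) ⟩
    maj (suc n) k ρ
      ≡⟨ maj-extend-top std 2k≤right ⟩
    maj n k ρ ∎
    where
    open ≡-Reasoning
    open StdSignedPartition std
    l≡o : left ≡ oddIx k
    l≡o = trans l≡r (trans (cong mirror r≡e) (mirror-evenIx k))
    2k<oddIx : 2 ℕ.* k < oddIx k
    2k<oddIx = ℕP.≤-reflexive (sym (oddIx≡ k))
    2k≤right : 2 ℕ.* k ≤ right
    2k≤right = subst (2 ℕ.* k ≤_) (sym (trans r≡e (evenIx≡ k))) (ℕP.m≤n⇒m≤1+n (ℕP.n≤1+n _))
    new-block : ∀ j → 2 ℕ.* k < j → Occurs (suc n) ρ j → nblk (suc n) ρ j ≡ 0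
    new-block j 2k<j occ = nblk-boundary (suc n) ρ j (mblk-suc-new n ρ j new occ)
      where
      new : ¬ Occurs n ρ j
      new (y , le , ρy≡j) = ℕP.<⇒≱ (bounded y le) (subst (_ ≤_) (sym ρy≡j) 2k<j)

-- Weighted sums in a commutative semiring

atPred : ∀ {a} {A : Set a} → A → (ℕ → A) → ℕ → A
atPred z f zero    = z
atPred z f (suc k) = f k

atPred-cong : ∀ {a} {A : Set a} {z : A} {f g : ℕ → A} → (∀ k → f k ≡ g k) → ∀ k → atPred z f k ≡ atPred z g k
atPred-cong f≗g zero    = refl
atPred-cong f≗g (suc k) = f≗g k

All-allLists : ∀ B l → All (λ vs → length vs ≡ l × All (_< B) vs) (allLists B l)
All-allLists B zero    = (refl , []) ∷ []
All-allLists B (suc l) =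
  AllP.concat⁺ (AllP.map⁺ (AllP.applyUpTo⁺₁ _ B λ v<B →
    AllP.map⁺ (All.map (λ (len , bounded) → cong suc len , v<B ∷ bounded) (All-allLists B l))))

module Weights {c ℓ} (R : CommutativeSemiring c ℓ) (q : CommutativeSemiring.Carrier R) where
  open CommutativeSemiring R
    using (Carrier; _≈_; _+_; _*_; 0#; 1#; setoid; +-cong; +-congˡ; +-congʳ; *-congˡ; *-congʳ;
           +-assoc; +-comm; +-identityˡ; +-identityʳ; *-assoc; *-comm; *-identityˡ; *-identityʳ;
           distribˡ; distribʳ; zeroˡ; zeroʳ; +-commutativeSemigroup)
    renaming (refl to ≈-refl; sym to ≈-sym; trans to ≈-trans; reflexive to ≈-reflexive)
  open QArith R q
  open import Relation.Binary.Reasoning.Setoid setoid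
  open import Algebra.Properties.CommutativeSemigroup +-commutativeSemigroup using (interchange)

  private variable A B : Set

  ∑ : List A → (A → Carrier) → Carrier
  ∑ []       f = 0#
  ∑ (x ∷ xs) f = f x + ∑ xs f

  ∑-congᴬ : ∀ {P : A → Set} {xs} {f g : A → Carrier} → All P xs → (∀ {x} → P x → f x ≈ g x) → ∑ xs f ≈ ∑ xs g
  ∑-congᴬ []         _ = ≈-refl
  ∑-congᴬ (px ∷ pxs) h = +-cong (h px) (∑-congᴬ pxs h)

  ∑-cong : ∀ (xs : List A) {f g : A → Carrier} → (∀ x → f x ≈ g x) → ∑ xs f ≈ ∑ xs g
  ∑-cong []       _ = ≈-refl
  ∑-cong (x ∷ xs) h = +-cong (h x) (∑-cong xs h)

  ∑-zero : ∀ {P : A → Set} {xs} {f : A → Carrier} → All P xs → (∀ {x} → P x → f x ≈ 0#) → ∑ xs f ≈ 0#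
  ∑-zero []         _ = ≈-refl
  ∑-zero (px ∷ pxs) h = ≈-trans (+-cong (h px) (∑-zero pxs h)) (+-identityˡ 0#)

  ∑-++ : ∀ (xs ys : List A) (f : A → Carrier) → ∑ (xs ++ ys) f ≈ ∑ xs f + ∑ ys f
  ∑-++ []       ys f = ≈-sym (+-identityˡ _)
  ∑-++ (x ∷ xs) ys f = ≈-trans (+-congˡ (∑-++ xs ys f)) (≈-sym (+-assoc _ _ _))

  ∑-+ : ∀ (xs : List A) (f g : A → Carrier) → ∑ xs (λ x → f x + g x) ≈ ∑ xs f + ∑ xs g
  ∑-+ []       f g = ≈-sym (+-identityˡ 0#)
  ∑-+ (x ∷ xs) f g = ≈-trans (+-congˡ (∑-+ xs f g)) (interchange _ _ _ _)

  ∑-*ˡ : ∀ (xs : List A) a (f : A → Carrier) → ∑ xs (λ x → a * f x) ≈ a * ∑ xs f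
  ∑-*ˡ []       a f = ≈-sym (zeroʳ a)
  ∑-*ˡ (x ∷ xs) a f = ≈-trans (+-congˡ (∑-*ˡ xs a f)) (≈-sym (distribˡ a _ _))

  ∑-swap : ∀ (xs : List A) (ys : List B) (F : A → B → Carrier) →
           ∑ xs (λ x → ∑ ys (F x)) ≈ ∑ ys (λ y → ∑ xs (λ x → F x y))
  ∑-swap []       ys F = ≈-sym (∑-zero {P = λ _ → ⊤} {ys} {λ _ → 0#} (All.tabulate (λ _ → tt)) (λ _ → ≈-refl))
  ∑-swap (x ∷ xs) ys F =
    ≈-trans (+-congˡ (∑-swap xs ys F)) (≈-sym (∑-+ ys (F x) (λ y → ∑ xs (λ x′ → F x′ y))))

  ∑-map : ∀ (g : A → B) xs (f : B → Carrier) → ∑ (map g xs) f ≡ ∑ xs (f ∘ g)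
  ∑-map g []       f = refl
  ∑-map g (x ∷ xs) f = cong (_+_ (f (g x))) (∑-map g xs f)

  ∑-concatMap : ∀ (g : A → List B) xs (f : B → Carrier) → ∑ (concatMap g xs) f ≈ ∑ xs (λ x → ∑ (g x) f)
  ∑-concatMap g []       f = ≈-refl
  ∑-concatMap g (x ∷ xs) f =
    ≈-trans (∑-++ (g x) (concatMap g xs) f) (+-congˡ {∑ (g x) f} (∑-concatMap g xs f))

  All-upTo : ∀ m → All (_< m) (upTo m)
  All-upTo m = AllP.applyUpTo⁺₁ (λ i → i) m (λ lt → lt)

  ∑-upTo-suc : ∀ m (f : ℕ → Carrier) → ∑ (upTo (suc m)) f ≡ f 0 + ∑ (upTo m) (f ∘ suc)
  ∑-upTo-suc m f =
    cong (_+_ (f 0)) (trans (cong (λ xs → ∑ xs f) (sym (LP.map-upTo suc m))) (∑-map suc (upTo m) f))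

  ∑-upTo-snoc : ∀ m (f : ℕ → Carrier) → ∑ (upTo (suc m)) f ≈ ∑ (upTo m) f + f m
  ∑-upTo-snoc m f = begin
    ∑ (upTo (suc m)) f           ≡⟨ cong (λ xs → ∑ xs f) (sym (LP.upTo-∷ʳ m)) ⟩
    ∑ (upTo m ++ (m ∷ [])) f     ≈⟨ ∑-++ (upTo m) (m ∷ []) f ⟩
    ∑ (upTo m) f + (f m + 0#)    ≈⟨ +-congˡ (+-identityʳ (f m)) ⟩
    ∑ (upTo m) f + f m           ∎

  ∑-upTo-single : ∀ {m c} (f : ℕ → Carrier) → c < m → (∀ {a} → a < m → a ≢ c → f a ≈ 0#) →
                  ∑ (upTo m) f ≈ f c
  ∑-upTo-single {suc m} {c} f (s≤s c≤m) others with ℕP.m≤n⇒m<n∨m≡n c≤m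
  ... | inj₁ c<m = begin
    ∑ (upTo (suc m)) f  ≈⟨ ∑-upTo-snoc m f ⟩
    ∑ (upTo m) f + f m  ≈⟨ +-cong (∑-upTo-single f c<m (others ∘ ℕP.m<n⇒m<1+n)) (others ℕP.≤-refl (ℕP.>⇒≢ c<m)) ⟩
    f c + 0#            ≈⟨ +-identityʳ (f c) ⟩
    f c                 ∎
  ... | inj₂ refl = begin
    ∑ (upTo (suc m)) f  ≈⟨ ∑-upTo-snoc m f ⟩
    ∑ (upTo m) f + f m  ≈⟨ +-congʳ (∑-zero (All-upTo m) (λ a<m → others (ℕP.m<n⇒m<1+n a<m) (ℕP.<⇒≢ a<m))) ⟩
    0# + f m            ≈⟨ +-identityˡ (f m) ⟩
    f m                 ∎

  ∑-upTo-truncate : ∀ {m m′} (f : ℕ → Carrier) → m′ ≤ m → (∀ {v} → m′ ≤ v → v < m → f v ≈ 0#) →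
                    ∑ (upTo m) f ≈ ∑ (upTo m′) f
  ∑-upTo-truncate {zero}  {zero} f _  _    = ≈-refl
  ∑-upTo-truncate {suc m} {m′}   f le high with ℕP.m≤n⇒m<n∨m≡n le
  ... | inj₂ refl     = ≈-refl
  ... | inj₁ (s≤s le′) = begin
    ∑ (upTo (suc m)) f  ≈⟨ ∑-upTo-snoc m f ⟩
    ∑ (upTo m) f + f m  ≈⟨ +-cong (∑-upTo-truncate f le′ (λ l h → high l (ℕP.m<n⇒m<1+n h))) (high le′ ℕP.≤-refl) ⟩
    ∑ (upTo m′) f + 0#  ≈⟨ +-identityʳ _ ⟩
    ∑ (upTo m′) f       ∎

  ∑-upTo-pow : ∀ m → ∑ (upTo m) pow ≈ qint m
  ∑-upTo-pow zero    = ≈-refl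
  ∑-upTo-pow (suc m) = begin
    ∑ (upTo (suc m)) pow               ≡⟨ ∑-upTo-suc m pow ⟩
    1# + ∑ (upTo m) (λ i → q * pow i)  ≈⟨ +-congˡ (∑-*ˡ (upTo m) q pow) ⟩
    1# + q * ∑ (upTo m) pow            ≈⟨ +-congˡ (*-congˡ (∑-upTo-pow m)) ⟩
    qint (suc m)                       ∎

  ∑-allLists-suc : ∀ B l (G : List ℕ → Carrier) →
                   ∑ (allLists B (suc l)) G ≈ ∑ (upTo B) (λ v → ∑ (allLists B l) (G ∘ (v ∷_)))
  ∑-allLists-suc B l G = ≈-trans (∑-concatMap (λ v → map (v ∷_) (allLists B l)) (upTo B) G)
                                 (∑-cong (upTo B) (λ v → ≈-reflexive (∑-map (v ∷_) (allLists B l) G)))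

  ∑-allLists-snoc : ∀ B l (G : List ℕ → Carrier) →
                    ∑ (allLists B (suc l)) G ≈ ∑ (allLists B l) (λ vs → ∑ (upTo B) (λ b → G (vs ++ (b ∷ []))))
  ∑-allLists-snoc B zero G = begin
    ∑ (allLists B 1) G                                ≈⟨ ∑-allLists-suc B 0 G ⟩
    ∑ (upTo B) (λ v → G (v ∷ []) + 0#)                ≈⟨ ∑-cong (upTo B) (λ v → +-identityʳ _) ⟩
    ∑ (upTo B) (λ b → G (b ∷ []))                     ≈⟨ +-identityʳ _ ⟨
    ∑ (allLists B 0) (λ vs → ∑ (upTo B) (λ b → G (vs ++ (b ∷ [])))) ∎
  ∑-allLists-snoc B (suc l) G = begin
    ∑ (allLists B (suc (suc l))) G
      ≈⟨ ∑-allLists-suc B (suc l) G ⟩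
    ∑ (upTo B) (λ v → ∑ (allLists B (suc l)) (G ∘ (v ∷_)))
      ≈⟨ ∑-cong (upTo B) (λ v → ∑-allLists-snoc B l (G ∘ (v ∷_))) ⟩
    ∑ (upTo B) (λ v → ∑ (allLists B l) (λ vs → ∑ (upTo B) (λ b → G (v ∷ (vs ++ (b ∷ []))))))
      ≈⟨ ∑-allLists-suc B l _ ⟨
    ∑ (allLists B (suc l)) (λ vs → ∑ (upTo B) (λ b → G (vs ++ (b ∷ [])))) ∎

  ∑-allLists-ends : ∀ B l (G : List ℕ → Carrier) →
    ∑ (allLists B (suc (suc l))) G ≈
    ∑ (allLists B l) (λ mid → ∑ (upTo B) (λ a → ∑ (upTo B) (λ b → G (a ∷ (mid ++ (b ∷ []))))))
  ∑-allLists-ends B l G = begin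
    ∑ (allLists B (suc (suc l))) G
      ≈⟨ ∑-allLists-suc B (suc l) G ⟩
    ∑ (upTo B) (λ a → ∑ (allLists B (suc l)) (G ∘ (a ∷_)))
      ≈⟨ ∑-cong (upTo B) (λ a → ∑-allLists-snoc B l (G ∘ (a ∷_))) ⟩
    ∑ (upTo B) (λ a → ∑ (allLists B l) (λ mid → ∑ (upTo B) (λ b → G (a ∷ (mid ++ (b ∷ []))))))
      ≈⟨ ∑-swap (upTo B) (allLists B l) _ ⟩
    ∑ (allLists B l) (λ mid → ∑ (upTo B) (λ a → ∑ (upTo B) (λ b → G (a ∷ (mid ++ (b ∷ [])))))) ∎

  ∑-allLists-truncate : ∀ {B B′} l (F : List ℕ → Carrier) → B′ ≤ B →
    (∀ vs → length vs ≡ l → ¬ All (_< B′) vs → F vs ≈ 0#) → ∑ (allLists B l) F ≈ ∑ (allLists B′ l) F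
  ∑-allLists-truncate zero    F _    _    = ≈-refl
  ∑-allLists-truncate {B} {B′} (suc l) F B′≤B high = begin
    ∑ (allLists B (suc l)) F
      ≈⟨ ∑-allLists-suc B l F ⟩
    ∑ (upTo B) (λ v → ∑ (allLists B l) (F ∘ (v ∷_)))
      ≈⟨ ∑-upTo-truncate _ B′≤B (λ B′≤v _ → ∑-zero (All-allLists B l) λ (len , _) →
           high _ (cong suc len) λ { (v<B′ ∷ _) → ℕP.<⇒≱ v<B′ B′≤v }) ⟩
    ∑ (upTo B′) (λ v → ∑ (allLists B l) (F ∘ (v ∷_)))
      ≈⟨ ∑-congᴬ (All-upTo B′) (λ {v} _ → ∑-allLists-truncate l (F ∘ (v ∷_)) B′≤B
           λ vs len bad → high (v ∷ vs) (cong suc len) λ { (_ ∷ good) → bad good }) ⟩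
    ∑ (upTo B′) (λ v → ∑ (allLists B′ l) (F ∘ (v ∷_)))
      ≈⟨ ∑-allLists-suc B′ l F ⟨
    ∑ (allLists B′ (suc l)) F ∎

  pow-+ : ∀ m e → pow (m ℕ.+ e) ≈ pow m * pow e
  pow-+ zero    e = ≈-sym (*-identityˡ (pow e))
  pow-+ (suc m) e = ≈-trans (*-congˡ (pow-+ m e)) (≈-sym (*-assoc q (pow m) (pow e)))

  weight : ℕ → ℕ → (ℤ → ℕ) → Carrier
  weight n k ρ = if isStdSignedPartition n k ρ then pow (maj n k ρ) else 0#

  weight-std : ∀ {n k ρ} → StdSignedPartition n k ρ → weight n k ρ ≡ pow (maj n k ρ)
  weight-std {n} {k} {ρ} std with isStdSignedPartition n k ρ | fromStd std
  ... | true | _ = refl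

  weight-nonstd : ∀ {n k ρ} → ¬ StdSignedPartition n k ρ → weight n k ρ ≡ 0#
  weight-nonstd {n} {k} {ρ} nonstd with isStdSignedPartition n k ρ in eq
  ... | true  = ⊥-elim (nonstd (toStd (subst T (sym eq) tt)))
  ... | false = refl

  weight-cong : ∀ {n ρ σ} → Agree n ρ σ → ∀ k → weight n k ρ ≡ weight n k σ
  weight-cong {n} {ρ} {σ} agree k with std? n k ρ
  ... | yes std   =
    trans (weight-std std) (trans (cong pow (maj-cong agree k)) (sym (weight-std (std-cong agree std))))
  ... | no nonstd =
    trans (weight-nonstd nonstd) (sym (weight-nonstd (nonstd ∘ std-cong λ x le → sym (agree x le))))

  weight-std-level-pred : ∀ {n k ρ} → StdSignedPartition n (suc k) ρ → weight n k ρ ≡ 0#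
  weight-std-level-pred {k = k} std = weight-nonstd λ std′ → std-level-≮ std′ std (ℕP.n<1+n k)

  weight-std-level-suc : ∀ {n k ρ} → StdSignedPartition n k ρ → weight n (suc k) ρ ≡ 0#
  weight-std-level-suc {k = k} std = weight-nonstd λ std′ → std-level-≮ std std′ (ℕP.n<1+n k)

  module _ (n : ℕ) (ρ : ℤ → ℕ) where
    open Extension n ρ

    weight-extend-unmirrored : ∀ k → left ≢ mirror right → weight (suc n) k ρ ≡ 0#
    weight-extend-unmirrored k l≢r = weight-nonstd (l≢r ∘ endpoints-mirrored {k})

    weight-extend-< : ∀ k → right < 2 ℕ.* k → left ≡ mirror right →
                      weight (suc n) k ρ ≈ weight n k ρ * pow (suc right)
    weight-extend-< k r<2k l≡r with std? (suc n) k ρ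
    ... | no nonstd = begin
      weight (suc n) k ρ        ≡⟨ weight-nonstd nonstd ⟩
      0#                        ≈⟨ zeroˡ _ ⟨
      0# * pow (suc right)      ≡⟨ cong (_* pow (suc right)) (sym (weight-nonstd (nonstd ∘ extended))) ⟩
      weight n k ρ * pow (suc right) ∎
      where
      extended : StdSignedPartition n k ρ → StdSignedPartition (suc n) k ρ
      extended std = extend std (ℕP.m≤n⇒m≤1+n r<2k) l≡r
    ... | yes std with restrict-or-newPair std
    ...   | inj₂ (k′ , refl , r≡e , _) = ⊥-elim (ℕP.<-irrefl r≡e r<2k)
    ...   | inj₁ stdₙ = begin
      weight (suc n) k ρ                         ≡⟨ weight-std std ⟩
      pow (maj (suc n) k ρ)                      ≡⟨ cong pow (maj-extend-< stdₙ r<2k) ⟩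
      pow (maj n k ρ ℕ.+ suc right)              ≈⟨ pow-+ (maj n k ρ) (suc right) ⟩
      pow (maj n k ρ) * pow (suc right)          ≡⟨ cong (_* pow (suc right)) (sym (weight-std stdₙ)) ⟩
      weight n k ρ * pow (suc right)             ∎

    weight-extend-top : ∀ k → right ≡ 2 ℕ.* k → left ≡ mirror right →
                        weight (suc n) k ρ ≈ weight n k ρ + atPred 0# (λ k′ → weight n k′ ρ) k
    weight-extend-top k r≡2k l≡r with std? (suc n) k ρ
    ... | no nonstd = begin
      weight (suc n) k ρ  ≡⟨ weight-nonstd nonstd ⟩
      0#                  ≈⟨ +-identityˡ 0# ⟨
      0# + 0#             ≡⟨ cong₂ _+_ (sym (weight-nonstd (nonstd ∘ extended))) (sym (no-newPair k nonstd r≡2k)) ⟩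
      weight n k ρ + atPred 0# (λ k′ → weight n k′ ρ) k ∎
      where
      extended : StdSignedPartition n k ρ → StdSignedPartition (suc n) k ρ
      extended std = extend std (subst (_< _) (sym r≡2k) ℕP.≤-refl) l≡r
      no-newPair : ∀ k → ¬ StdSignedPartition (suc n) k ρ → right ≡ 2 ℕ.* k →
                   atPred 0# (λ k′ → weight n k′ ρ) k ≡ 0#
      no-newPair zero     _      _    = refl
      no-newPair (suc k′) nonstd r≡2k = weight-nonstd (nonstd ∘ λ std → extend-newPair std r≡2k l≡r)
    ... | yes std with restrict-or-newPair std
    ...   | inj₁ stdₙ = begin
      weight (suc n) k ρ             ≡⟨ weight-std std ⟩
      pow (maj (suc n) k ρ)          ≡⟨ cong pow (maj-extend-top stdₙ (ℕP.≤-reflexive (sym r≡2k))) ⟩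
      pow (maj n k ρ)                ≡⟨ sym (weight-std stdₙ) ⟩
      weight n k ρ                   ≈⟨ +-identityʳ _ ⟨
      weight n k ρ + 0#              ≡⟨ cong (_+_ (weight n k ρ)) (sym (no-lower k stdₙ)) ⟩
      weight n k ρ + atPred 0# (λ k′ → weight n k′ ρ) k ∎
      where
      no-lower : ∀ k → StdSignedPartition n k ρ → atPred 0# (λ k′ → weight n k′ ρ) k ≡ 0#
      no-lower zero     _    = refl
      no-lower (suc k′) stdₙ = weight-std-level-pred stdₙ
    ...   | inj₂ (k′ , refl , r≡e , std′) = begin
      weight (suc n) (suc k′) ρ      ≡⟨ weight-std std ⟩
      pow (maj (suc n) (suc k′) ρ)   ≡⟨ cong pow (maj-extend-newPair std′ r≡e l≡r) ⟩
      pow (maj n k′ ρ)               ≡⟨ sym (weight-std std′) ⟩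
      weight n k′ ρ                  ≈⟨ +-identityˡ _ ⟨
      0# + weight n k′ ρ             ≡⟨ cong (_+ weight n k′ ρ) (sym (weight-std-level-suc std′)) ⟩
      weight n (suc k′) ρ + weight n k′ ρ ∎

  total : ℕ → ℕ → Carrier
  total n k = ∑ (allLists (suc (2 ℕ.* k)) (suc (2 ℕ.* n))) (weight n k ∘ fromValues n)

  collect : ∀ w x y → w * x + (w + y) ≈ (1# + x) * w + y
  collect w x y = begin
    w * x + (w + y)       ≈⟨ +-assoc (w * x) w y ⟨
    w * x + w + y         ≈⟨ +-congʳ (+-comm (w * x) w) ⟩
    w + w * x + y         ≈⟨ +-congʳ (+-cong (*-identityˡ w) (*-comm x w)) ⟨
    1# * w + x * w + y    ≈⟨ +-congʳ (distribʳ w 1# x) ⟨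
    (1# + x) * w + y      ∎

  module _ (n : ℕ) (mid : List ℕ) (len : length mid ≡ suc (2 ℕ.* n)) where
    private
      ρ₀ : ℤ → ℕ
      ρ₀ = fromValues n mid

      left≡ : ∀ a b → withEnds n a b mid -[1+ n ] ≡ a
      left≡ a b = withEnds-left n a b mid

      right≡ : ∀ a b → withEnds n a b mid (+ suc n) ≡ b
      right≡ a b = withEnds-right n a b mid len

      mirrored≡ : ∀ b → withEnds n (mirror b) b mid -[1+ n ] ≡ mirror (withEnds n (mirror b) b mid (+ suc n))
      mirrored≡ b = trans (left≡ (mirror b) b) (cong mirror (sym (right≡ (mirror b) b)))

      inner : ∀ k a b → weight n k (withEnds n a b mid) ≡ weight n k ρ₀
      inner k a b = weight-cong (withEnds-inner n a b mid len) k

    weight-withEnds-unmirrored : ∀ k {a b} → a ≢ mirror b → weight (suc n) k (withEnds n a b mid) ≡ 0#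
    weight-withEnds-unmirrored k {a} {b} a≢ = weight-extend-unmirrored n (withEnds n a b mid) k λ eq →
      a≢ (trans (sym (left≡ a b)) (trans eq (cong mirror (right≡ a b))))

    weight-withEnds-< : ∀ k {b} → b < 2 ℕ.* k →
                        weight (suc n) k (withEnds n (mirror b) b mid) ≈ weight n k ρ₀ * pow (suc b)
    weight-withEnds-< k {b} b<2k = begin
      weight (suc n) k ρ
        ≈⟨ weight-extend-< n ρ k (subst (_< _) (sym (right≡ (mirror b) b)) b<2k) (mirrored≡ b) ⟩
      weight n k ρ * pow (suc (ρ (+ suc n)))
        ≡⟨ cong₂ (λ w r → w * pow (suc r)) (inner k (mirror b) b) (right≡ (mirror b) b) ⟩
      weight n k ρ₀ * pow (suc b) ∎
      where ρ = withEnds n (mirror b) b mid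

    weight-withEnds-top : ∀ k → let b = 2 ℕ.* k in
      weight (suc n) k (withEnds n (mirror b) b mid) ≈ weight n k ρ₀ + atPred 0# (λ k′ → weight n k′ ρ₀) k
    weight-withEnds-top k = begin
      weight (suc n) k ρ
        ≈⟨ weight-extend-top n ρ k (right≡ (mirror (2 ℕ.* k)) (2 ℕ.* k)) (mirrored≡ (2 ℕ.* k)) ⟩
      weight n k ρ + atPred 0# (λ k′ → weight n k′ ρ) k
        ≡⟨ cong₂ _+_ (inner k _ _) (atPred-cong (λ k′ → inner k′ _ _) k) ⟩
      weight n k ρ₀ + atPred 0# (λ k′ → weight n k′ ρ₀) k ∎
      where ρ = withEnds n (mirror (2 ℕ.* k)) (2 ℕ.* k) mid

    ∑-endpoints : ∀ k → let K = suc (2 ℕ.* k) in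
      ∑ (upTo K) (λ a → ∑ (upTo K) (λ b → weight (suc n) k (withEnds n a b mid)))
        ≈ qint K * weight n k ρ₀ + atPred 0# (λ k′ → weight n k′ ρ₀) k
    ∑-endpoints k = begin
      ∑ (upTo K) (λ a → ∑ (upTo K) (λ b → weight (suc n) k (withEnds n a b mid)))
        ≈⟨ ∑-swap (upTo K) (upTo K) _ ⟩
      ∑ (upTo K) (λ b → ∑ (upTo K) (λ a → weight (suc n) k (withEnds n a b mid)))
        ≈⟨ ∑-congᴬ (All-upTo K) (λ b<K → ∑-upTo-single _ (mirror-< {k = k} b<K)
             λ _ a≢ → ≈-reflexive (weight-withEnds-unmirrored k a≢)) ⟩
      ∑ (upTo K) (λ b → weight (suc n) k (withEnds n (mirror b) b mid))
        ≈⟨ ∑-upTo-snoc (2 ℕ.* k) _ ⟩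
      ∑ (upTo (2 ℕ.* k)) (λ b → weight (suc n) k (withEnds n (mirror b) b mid))
        + weight (suc n) k (withEnds n (mirror (2 ℕ.* k)) (2 ℕ.* k) mid)
        ≈⟨ +-cong (∑-congᴬ (All-upTo (2 ℕ.* k)) (weight-withEnds-< k)) (weight-withEnds-top k) ⟩
      ∑ (upTo (2 ℕ.* k)) (λ b → w * (q * pow b)) + (w + below)
        ≈⟨ +-congʳ (∑-*ˡ (upTo (2 ℕ.* k)) w (pow ∘ suc)) ⟩
      w * ∑ (upTo (2 ℕ.* k)) (λ b → q * pow b) + (w + below)
        ≈⟨ +-congʳ (*-congˡ (≈-trans (∑-*ˡ (upTo (2 ℕ.* k)) q pow) (*-congˡ (∑-upTo-pow (2 ℕ.* k))))) ⟩
      w * (q * qint (2 ℕ.* k)) + (w + below)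
        ≈⟨ collect w _ below ⟩
      qint K * w + below ∎
      where
      K = suc (2 ℕ.* k)
      w = weight n k ρ₀
      below = atPred 0# (λ k′ → weight n k′ ρ₀) k

  no-std-at-0 : ∀ {k ρ} → ¬ StdSignedPartition 0 (suc k) ρ
  no-std-at-0 std with StdSignedPartition.occurs std (s≤s (s≤s z≤n))
  ... | + zero , _ , ρ0≡1 with trans (sym (StdSignedPartition.zero∈S₀ std)) ρ0≡1
  ...   | ()

  total-suc : ∀ n k → total (suc n) k ≈ qint (suc (2 ℕ.* k)) * total n k + atPred 0# (total n) k
  total-suc n k = begin
    ∑ (allLists K (suc (2 ℕ.* suc n))) (weight (suc n) k ∘ fromValues (suc n))
      ≡⟨ cong (λ l → ∑ (allLists K (suc l)) (weight (suc n) k ∘ fromValues (suc n))) (ℕP.*-suc 2 n) ⟩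
    ∑ (allLists K (suc (suc l))) (weight (suc n) k ∘ fromValues (suc n))
      ≈⟨ ∑-allLists-ends K l _ ⟩
    ∑ (allLists K l) (λ mid → ∑ (upTo K) (λ a → ∑ (upTo K) (λ b → weight (suc n) k (withEnds n a b mid))))
      ≈⟨ ∑-congᴬ (All-allLists K l) (λ (len , _) → ∑-endpoints n _ len k) ⟩
    ∑ (allLists K l) (λ mid → qint K * weight n k (fromValues n mid) + below k mid)
      ≈⟨ ∑-+ (allLists K l) _ _ ⟩
    ∑ (allLists K l) (λ mid → qint K * weight n k (fromValues n mid)) + ∑ (allLists K l) (below k)
      ≈⟨ +-cong (∑-*ˡ (allLists K l) (qint K) _) (∑-below k) ⟩
    qint K * total n k + atPred 0# (total n) k ∎
    where
    K = suc (2 ℕ.* k)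
    l = suc (2 ℕ.* n)
    below : ℕ → List ℕ → Carrier
    below k mid = atPred 0# (λ k′ → weight n k′ (fromValues n mid)) k
    ∑-below : ∀ k → ∑ (allLists (suc (2 ℕ.* k)) l) (below k) ≈ atPred 0# (total n) k
    ∑-below zero    = ∑-zero (All-allLists 1 l) (λ _ → ≈-refl)
    ∑-below (suc k) = ∑-allLists-truncate l _ (s≤s (ℕP.*-monoʳ-≤ 2 (ℕP.n≤1+n k))) λ vs len unbounded →
      ≈-reflexive (weight-nonstd (unbounded ∘ fromValues-bounded n k vs len))

  SB≈total : ∀ n k → SB n k ≈ total n k
  SB≈total zero    zero    = ≈-sym (+-identityʳ 1#)
  SB≈total zero    (suc k) =
    ≈-sym (∑-zero {f = weight 0 (suc k) ∘ fromValues 0} (All-allLists (suc (2 ℕ.* suc k)) 1)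
                  λ {vs} _ → ≈-reflexive (weight-nonstd {ρ = fromValues 0 vs} no-std-at-0))
  SB≈total (suc n) k       = begin
    SB (suc n) k                                      ≈⟨ SB-suc k ⟩
    qint (suc (2 ℕ.* k)) * SB n k + atPred 0# (SB n) k  ≈⟨ +-cong (*-congˡ (SB≈total n k)) (below k) ⟩
    qint (suc (2 ℕ.* k)) * total n k + atPred 0# (total n) k ≈⟨ total-suc n k ⟨
    total (suc n) k                                   ∎
    where
    SB-suc : ∀ k → SB (suc n) k ≈ qint (suc (2 ℕ.* k)) * SB n k + atPred 0# (SB n) k
    SB-suc zero    = ≈-sym (+-identityʳ _)
    SB-suc (suc k) = +-comm (SB n k) _
    below : ∀ k → atPred 0# (SB n) k ≈ atPred 0# (total n) k
    below zero    = ≈-refl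
    below (suc k) = SB≈total n k

  ∑-signedPartitions : ∀ n k →
    sumR (map (λ ρ → pow (maj n k ρ)) (signedPartitions n k)) ≈ total n k
  ∑-signedPartitions n k =
    ≈-trans (sum-filter (map (fromValues n) vss)) (≈-reflexive (∑-map (fromValues n) vss (weight n k)))
    where
    vss = allLists (suc (2 ℕ.* k)) (suc (2 ℕ.* n))
    sum-filter : ∀ ρs → sumR (map (λ ρ → pow (maj n k ρ)) (filter (λ ρ → T? (isStdSignedPartition n k ρ)) ρs))
                        ≈ ∑ ρs (weight n k)
    sum-filter []       = ≈-refl
    sum-filter (ρ ∷ ρs) with isStdSignedPartition n k ρ
    ... | true  = +-congˡ (sum-filter ρs)
    ... | false = ≈-trans (sum-filter ρs) (≈-sym (+-identityˡ _))

theorem3p10 : ∀ {c ℓ} (R : CommutativeSemiring c ℓ) (q : CommutativeSemiring.Carrier R) (n k : ℕ) →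
    CommutativeSemiring._≈_ R (QArith.SB R q n k)
    (QArith.sumR R q (map (λ ρ → QArith.pow R q (maj n k ρ)) (signedPartitions n k)))
theorem3p10 R q n k = ≈-trans (SB≈total n k) (≈-sym (∑-signedPartitions n k))
  where
  open Weights R q
  open CommutativeSemiring R using () renaming (trans to ≈-trans; sym to ≈-sym)
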